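{- Let $p$ be a prime, let $a$ be a positive integer and let $d\in\{1,\ldots,p^a-1\}$. For $e\in\{0,1,\ldots,p^a\}$ set $$S_e=\sum_{0<k<e}\frac{(-1)^{k-1}}{k}\left(\frac{e-k}{3}\right),\qquad F(e)=\frac12\left(\sum_{k=0}^{p^a-1}\binom{2k}{k+e}-\left(\frac{p^a-e}{3}\right)\right)+(-1)^{p}p^aS_e-p\,[p=3]\left(\frac{e}{3}\right).$$ Then $$F(d-1)+F(d)+F(d+1)\equiv2\binom{p^a}{d}-p^a\left(\frac{(-1)^{p^a-d}}{d}+(-1)^{p^a-1}\frac{(-1)^d}{p^a-d}\right)\pmod{p^3},$$ and moreover $F(d-1)+F(d)+F(d+1)\equiv0\pmod{p^2}$.
   Context: For an integer $x$, $\left(\frac{x}{3}\right)\in\{0,1,-1\}$ denotes the Legendre symbol modulo 3, i.e. the unique element of $\{0,\pm1\}$ congruent to $x$ modulo 3. For an assertion $A$, $[A]$ equals $1$ if $A$ holds and $0$ otherwise. $\binom{n}{k}=0$ if $k>n$ or $k<0$. For rational numbers $x,y$, $x\equiv y\pmod{p^m}$ means that $(x-y)/p^m$ is a rational number whose denominator is not divisible by $p$. -}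

module Defs where

open import Data.Nat as ℕ using (ℕ; zero; suc; _∸_; _^_)
open import Data.Nat.Combinatorics using (_C_)
open import Data.Nat.Divisibility using (_∣_)
open import Data.Integer as ℤ using (ℤ; +_; -[1+_])
open import Data.Integer.DivMod using (_%ℕ_)
open import Data.Rational as ℚ using (ℚ; 0ℚ; 1ℚ; ½; _+_; _-_; _*_; -_; ↧ₙ_)
open import Data.Bool using (if_then_else_)
open import Data.Product using (∃; _×_)
open import Relation.Binary.PropositionalEquality using (_≡_)
open import Relation.Nullary using (¬_)

leg3 : ℤ → ℤ
leg3 x with x %ℕ 3
... | 0 = + 0
... | 1 = + 1
... | _ = -[1+ 0 ]

ℕ→ℚ : ℕ → ℚ
ℕ→ℚ n = + n ℚ./ 1

ℤ→ℚ : ℤ → ℚ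
ℤ→ℚ z = z ℚ./ 1

-- reciprocal 1/n of a natural number (only ever applied to n ≥ 1;
-- the value at 0 is an irrelevant convention)
recip : ℕ → ℚ
recip zero    = 0ℚ
recip (suc n) = + 1 ℚ./ suc n

neg1^ : ℕ → ℚ
neg1^ zero    = 1ℚ
neg1^ (suc n) = - neg1^ n

sumℚ : ℕ → (ℕ → ℚ) → ℚ
sumℚ zero    f = 0ℚ
sumℚ (suc n) f = sumℚ n f + f n

iv3 : ℕ → ℚ
iv3 p = if p ℕ.≡ᵇ 3 then 1ℚ else 0ℚ

-- S_e = Σ_{0<k<e} (-1)^{k-1}/k * (e-k / 3); we write k = j+1, j = 0..e-2
S : ℕ → ℚ
S e = sumℚ (e ∸ 1) (λ j → neg1^ j * recip (suc j) * ℤ→ℚ (leg3 (+ e ℤ.- + suc j)))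

F : (p a e : ℕ) → ℚ
F p a e =
  ½ * (sumℚ (p ^ a) (λ k → ℕ→ℚ ((2 ℕ.* k) C (k ℕ.+ e)))
        - ℤ→ℚ (leg3 (+ (p ^ a) ℤ.- + e)))
  + neg1^ p * ℕ→ℚ (p ^ a) * S e
  - ℕ→ℚ p * iv3 p * ℤ→ℚ (leg3 (+ e))

-- x ≡ y (mod p^m) for rationals: (x - y)/p^m is a rational z whose
-- denominator is not divisible by p (stated as x - y = p^m * z)
_≡_[mod_^_] : ℚ → ℚ → ℕ → ℕ → Set
x ≡ y [mod p ^ m ] = ∃ λ (z : ℚ) → (x - y ≡ ℕ→ℚ (p ^ m) * z) × ¬ (p ∣ ↧ₙ z)

module Submission where

-- Proof outline, with ε = (-1)^p, σ = (-1)^d and x_i = q/i: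
-- 1. ThreeConsecutive: the Legendre-symbol terms of three consecutive F cancel,
--    S telescopes and the binomial sums add up by Pascal's rule, so the sum is
--    ½ C(2q, q+d) - ε σ x_d.
-- 2. BinomialProducts: C(q+n, n) = Π_{i≤n} (1 + x_i) and C(q-1, n) = (-1)^n Π_{i≤n} (1 - x_i);
--    hence C(2q, q+d) B = 2 Y C(q, d) with B = C(q+d, d), Y = C(2q-1, q-1), and
--    C(q, d) = -σ x_d Π_{i<d} (1 - x_i).
-- 3. PAdic, Congruences: p divides x_i for 0 < i < q, so these products are ≡ 1 (mod p),
--    Π (1 + x_i)(1 - x_i) ≡ 1 (mod p²), and pairing i with q - i gives Y ≡ 2 + ε (mod p²).
-- 4. Multiplying the two differences by the units B(1 - x_d), resp. B, turns them into
--    -σ x_d times combinations that vanish mod p², resp. mod p; as p ∣ x_d and division by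
--    a unit preserves divisibility by p^k, the differences are divisible by p³, resp. p².

open import Data.Nat using (ℕ; _<_)
open import Data.Nat.Primality using (Prime)

module Embedding where
  open import Defs
  open import Data.Rational using (1ℚ; _+_; _-_; _*_; -_; toℚᵘ)
  open import Data.Rational.Properties
    using (toℚᵘ-injective; toℚᵘ-fromℚᵘ; toℚᵘ-homo-+; toℚᵘ-homo-*; neg-distribˡ-*; *-identityˡ; *-identityʳ)
  import Data.Rational.Unnormalised as U
  import Data.Rational.Unnormalised.Properties as UP
  open import Data.Integer as ℤ using (ℤ; +_)
  import Data.Integer.Properties as ℤP
  open import Data.Nat as ℕ using (ℕ; suc; zero)
  import Data.Nat.Properties as ℕP
  open import Relation.Binary.PropositionalEquality
  open import Data.Rational.Solver
  open +-*-Solver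

  toℚᵘ-ℤ→ℚ : ∀ i → toℚᵘ (ℤ→ℚ i) U.≃ U.mkℚᵘ i 0
  toℚᵘ-ℤ→ℚ i = toℚᵘ-fromℚᵘ (U.mkℚᵘ i 0)

  ℤ→ℚ-+ : ∀ a b → ℤ→ℚ (a ℤ.+ b) ≡ ℤ→ℚ a + ℤ→ℚ b
  ℤ→ℚ-+ a b = toℚᵘ-injective (UP.≃-trans (toℚᵘ-ℤ→ℚ (a ℤ.+ b)) (UP.≃-trans (U.*≡* fractions)
    (UP.≃-sym (UP.≃-trans (toℚᵘ-homo-+ (ℤ→ℚ a) (ℤ→ℚ b)) (UP.+-cong (toℚᵘ-ℤ→ℚ a) (toℚᵘ-ℤ→ℚ b))))))
    where
    fractions : (a ℤ.+ b) ℤ.* + 1 ≡ (a ℤ.* + 1 ℤ.+ b ℤ.* + 1) ℤ.* + 1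
    fractions = cong (ℤ._* + 1) (sym (cong₂ ℤ._+_ (ℤP.*-identityʳ a) (ℤP.*-identityʳ b)))

  ℤ→ℚ-* : ∀ a b → ℤ→ℚ (a ℤ.* b) ≡ ℤ→ℚ a * ℤ→ℚ b
  ℤ→ℚ-* a b = toℚᵘ-injective (UP.≃-trans (toℚᵘ-ℤ→ℚ (a ℤ.* b))
    (UP.≃-sym (UP.≃-trans (toℚᵘ-homo-* (ℤ→ℚ a) (ℤ→ℚ b)) (UP.*-cong (toℚᵘ-ℤ→ℚ a) (toℚᵘ-ℤ→ℚ b)))))

  ℕ→ℚ-+ : ∀ m n → ℕ→ℚ (m ℕ.+ n) ≡ ℕ→ℚ m + ℕ→ℚ n
  ℕ→ℚ-+ m n = ℤ→ℚ-+ (+ m) (+ n)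

  ℕ→ℚ-* : ∀ m n → ℕ→ℚ (m ℕ.* n) ≡ ℕ→ℚ m * ℕ→ℚ n
  ℕ→ℚ-* m n = trans (cong ℤ→ℚ (ℤP.pos-* m n)) (ℤ→ℚ-* (+ m) (+ n))

  ℕ→ℚ-∸ : ∀ m n → n ℕ.≤ m → ℕ→ℚ (m ℕ.∸ n) ≡ ℕ→ℚ m - ℕ→ℚ n
  ℕ→ℚ-∸ m n n≤m = begin
    ℕ→ℚ (m ℕ.∸ n)                     ≡⟨ solve 2 (λ x y → x := (x :+ y) :- y) refl (ℕ→ℚ (m ℕ.∸ n)) (ℕ→ℚ n) ⟩
    (ℕ→ℚ (m ℕ.∸ n) + ℕ→ℚ n) - ℕ→ℚ n ≡⟨ cong (_- ℕ→ℚ n) (sym (ℕ→ℚ-+ (m ℕ.∸ n) n)) ⟩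
    ℕ→ℚ (m ℕ.∸ n ℕ.+ n) - ℕ→ℚ n      ≡⟨ cong (λ k → ℕ→ℚ k - ℕ→ℚ n) (ℕP.m∸n+n≡m n≤m) ⟩
    ℕ→ℚ m - ℕ→ℚ n ∎
    where open ≡-Reasoning

  recip-inverse : ∀ n → .{{ℕ.NonZero n}} → ℕ→ℚ n * recip n ≡ 1ℚ
  recip-inverse (suc n) = toℚᵘ-injective (UP.≃-trans (toℚᵘ-homo-* (ℕ→ℚ (suc n)) (recip (suc n)))
    (UP.≃-trans (UP.*-cong (toℚᵘ-ℤ→ℚ (+ suc n)) (toℚᵘ-fromℚᵘ (U.mkℚᵘ (+ 1) n))) (U.*≡* cross)))
    where
    cross : (+ suc n ℤ.* + 1) ℤ.* + 1 ≡ + 1 ℤ.* (+ 1 ℤ.* + suc n)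
    cross = trans (ℤP.*-identityʳ (+ suc n ℤ.* + 1)) (trans (ℤP.*-identityʳ (+ suc n))
              (sym (trans (ℤP.*-identityˡ (+ 1 ℤ.* + suc n)) (ℤP.*-identityˡ (+ suc n)))))

  recip-unique : ∀ n x → .{{ℕ.NonZero n}} → ℕ→ℚ n * x ≡ 1ℚ → x ≡ recip n
  recip-unique n x nx≡1 = begin
    x                       ≡⟨ sym (*-identityʳ x) ⟩
    x * 1ℚ                  ≡⟨ cong (x *_) (sym (recip-inverse n)) ⟩
    x * (ℕ→ℚ n * recip n)   ≡⟨ solve 3 (λ x n r → x :* (n :* r) := (n :* x) :* r) refl x (ℕ→ℚ n) (recip n) ⟩
    (ℕ→ℚ n * x) * recip n   ≡⟨ cong (_* recip n) nx≡1 ⟩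
    1ℚ * recip n            ≡⟨ *-identityˡ (recip n) ⟩
    recip n ∎
    where open ≡-Reasoning

  recip-* : ∀ m n → .{{_ : ℕ.NonZero m}} → .{{_ : ℕ.NonZero n}} → recip (m ℕ.* n) ≡ recip m * recip n
  recip-* m n = sym (recip-unique (m ℕ.* n) (recip m * recip n) {{ℕP.m*n≢0 m n}} (begin
    ℕ→ℚ (m ℕ.* n) * (recip m * recip n)           ≡⟨ cong (_* (recip m * recip n)) (ℕ→ℚ-* m n) ⟩
    ℕ→ℚ m * ℕ→ℚ n * (recip m * recip n)           ≡⟨ solve 4 (λ a b c d → a :* b :* (c :* d) := (a :* c) :* (b :* d)) refl (ℕ→ℚ m) (ℕ→ℚ n) (recip m) (recip n) ⟩
    (ℕ→ℚ m * recip m) * (ℕ→ℚ n * recip n)         ≡⟨ cong₂ _*_ (recip-inverse m) (recip-inverse n) ⟩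
    1ℚ ∎))
    where open ≡-Reasoning

  neg1^-+ : ∀ m n → neg1^ (m ℕ.+ n) ≡ neg1^ m * neg1^ n
  neg1^-+ zero    n = sym (*-identityˡ (neg1^ n))
  neg1^-+ (suc m) n = trans (cong -_ (neg1^-+ m n)) (neg-distribˡ-* (neg1^ m) (neg1^ n))

  neg1^-square : ∀ n → neg1^ n * neg1^ n ≡ 1ℚ
  neg1^-square zero    = refl
  neg1^-square (suc n) = trans (solve 1 (λ s → (:- s) :* (:- s) := s :* s) refl (neg1^ n)) (neg1^-square n)

module FiniteSums where
  open import Defs
  open import Data.Rational using (ℚ; 0ℚ; 1ℚ; _+_; _*_)
  open import Data.Rational.Properties using (+-identityʳ; *-identityˡ; *-identityʳ)
  open import Data.Rational.Solver
  open +-*-Solver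
  open import Data.Nat as ℕ using (ℕ; suc; zero; _∸_)
  import Data.Nat.Properties as ℕP
  open import Relation.Binary.PropositionalEquality

  prodℚ : ℕ → (ℕ → ℚ) → ℚ
  prodℚ zero    f = 1ℚ
  prodℚ (suc n) f = prodℚ n f * f n

  sum-cong : ∀ n {f g} → (∀ j → j ℕ.< n → f j ≡ g j) → sumℚ n f ≡ sumℚ n g
  sum-cong zero    f≡g = refl
  sum-cong (suc n) f≡g = cong₂ _+_ (sum-cong n (λ j j<n → f≡g j (ℕP.m<n⇒m<1+n j<n))) (f≡g n ℕP.≤-refl)

  sum-+ : ∀ n f g → sumℚ n (λ j → f j + g j) ≡ sumℚ n f + sumℚ n g
  sum-+ zero    f g = refl
  sum-+ (suc n) f g = trans (cong (_+ (f n + g n)) (sum-+ n f g))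
    (solve 4 (λ a b c d → (a :+ b) :+ (c :+ d) := (a :+ c) :+ (b :+ d)) refl (sumℚ n f) (sumℚ n g) (f n) (g n))

  sum-zero : ∀ n f → (∀ j → j ℕ.< n → f j ≡ 0ℚ) → sumℚ n f ≡ 0ℚ
  sum-zero n f f≡0 = trans (sum-cong n f≡0) (sum-of-zeros n)
    where
    sum-of-zeros : ∀ n → sumℚ n (λ _ → 0ℚ) ≡ 0ℚ
    sum-of-zeros zero    = refl
    sum-of-zeros (suc n) = trans (+-identityʳ _) (sum-of-zeros n)

  prod-cong : ∀ n {f g} → (∀ j → j ℕ.< n → f j ≡ g j) → prodℚ n f ≡ prodℚ n g
  prod-cong zero    f≡g = refl
  prod-cong (suc n) f≡g = cong₂ _*_ (prod-cong n (λ j j<n → f≡g j (ℕP.m<n⇒m<1+n j<n))) (f≡g n ℕP.≤-refl)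

  prod-* : ∀ n f g → prodℚ n (λ j → f j * g j) ≡ prodℚ n f * prodℚ n g
  prod-* zero    f g = refl
  prod-* (suc n) f g = trans (cong (_* (f n * g n)) (prod-* n f g))
    (solve 4 (λ a b c d → (a :* b) :* (c :* d) := (a :* c) :* (b :* d)) refl (prodℚ n f) (prodℚ n g) (f n) (g n))

  prod-first : ∀ n f → prodℚ (suc n) f ≡ f 0 * prodℚ n (λ j → f (suc j))
  prod-first zero    f = trans (*-identityˡ (f 0)) (sym (*-identityʳ (f 0)))
  prod-first (suc n) f = trans (cong (_* f (suc n)) (prod-first n f))
    (solve 3 (λ a b c → (a :* b) :* c := a :* (b :* c)) refl (f 0) (prodℚ n (λ j → f (suc j))) (f (suc n)))

  prod-pairs-even : ∀ m f → prodℚ (m ℕ.+ m) f ≡ prodℚ m (λ j → f j * f (m ℕ.+ m ∸ suc j))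
  prod-pairs-even zero    f = refl
  prod-pairs-even (suc m) f rewrite ℕP.+-suc m m = begin
    prodℚ (suc (2m)) f * f (suc (2m))            ≡⟨ cong (_* f (suc (2m))) (prod-first (2m) f) ⟩
    f 0 * prodℚ (2m) f⁺ * f (suc (2m))            ≡⟨ cong (λ t → f 0 * t * f (suc (2m))) (prod-pairs-even m f⁺) ⟩
    f 0 * inner * f (suc (2m))                     ≡⟨ solve 3 (λ a b c → a :* b :* c := (a :* c) :* b) refl (f 0) inner (f (suc (2m))) ⟩
    f 0 * f (suc (2m)) * inner                     ≡⟨ cong (f 0 * f (suc (2m)) *_) (prod-cong m reindex) ⟩
    f 0 * f (suc (2m)) * prodℚ m (λ j → f (suc j) * f (suc (2m) ∸ suc j))
                                                   ≡⟨ sym (prod-first m (λ j → f j * f (suc (suc (2m)) ∸ suc j))) ⟩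
    prodℚ (suc m) (λ j → f j * f (suc (suc (2m)) ∸ suc j)) ∎
    where
    open ≡-Reasoning
    2m : ℕ
    2m = m ℕ.+ m
    f⁺ : ℕ → ℚ
    f⁺ j = f (suc j)
    inner : ℚ
    inner = prodℚ m (λ j → f⁺ j * f⁺ (2m ∸ suc j))
    reindex : ∀ j → j ℕ.< m → f⁺ j * f⁺ (2m ∸ suc j) ≡ f (suc j) * f (suc (2m) ∸ suc j)
    reindex j j<m = cong (λ t → f (suc j) * f t) (sym (ℕP.+-∸-assoc 1 (ℕP.≤-trans j<m (ℕP.m≤m+n m m))))

  prod-pairs-odd : ∀ m f → prodℚ (suc (m ℕ.+ m)) f ≡ prodℚ m (λ j → f j * f (m ℕ.+ m ∸ j)) * f m
  prod-pairs-odd zero    f = refl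
  prod-pairs-odd (suc m) f rewrite ℕP.+-suc m m = begin
    prodℚ (suc (suc (2m))) f * f (suc (suc (2m)))  ≡⟨ cong (_* f (suc (suc (2m)))) (prod-first (suc (2m)) f) ⟩
    f 0 * prodℚ (suc (2m)) f⁺ * f (suc (suc (2m))) ≡⟨ cong (λ t → f 0 * t * f (suc (suc (2m)))) (prod-pairs-odd m f⁺) ⟩
    f 0 * (inner * f (suc m)) * f (suc (suc (2m))) ≡⟨ solve 4 (λ a b c d → a :* (b :* c) :* d := (a :* d) :* b :* c) refl (f 0) inner (f (suc m)) (f (suc (suc (2m)))) ⟩
    f 0 * f (suc (suc (2m))) * inner * f (suc m)   ≡⟨ cong (λ t → f 0 * f (suc (suc (2m))) * t * f (suc m)) (prod-cong m reindex) ⟩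
    f 0 * f (suc (suc (2m))) * prodℚ m (λ j → f (suc j) * f (suc (2m) ∸ j)) * f (suc m)
                                                    ≡⟨ cong (_* f (suc m)) (sym (prod-first m (λ j → f j * f (suc (suc (2m)) ∸ j)))) ⟩
    prodℚ (suc m) (λ j → f j * f (suc (suc (2m)) ∸ j)) * f (suc m) ∎
    where
    open ≡-Reasoning
    2m : ℕ
    2m = m ℕ.+ m
    f⁺ : ℕ → ℚ
    f⁺ j = f (suc j)
    inner : ℚ
    inner = prodℚ m (λ j → f⁺ j * f⁺ (2m ∸ j))
    reindex : ∀ j → j ℕ.< m → f⁺ j * f⁺ (2m ∸ j) ≡ f (suc j) * f (suc (2m) ∸ j)
    reindex j j<m = cong (λ t → f (suc j) * f t) (sym (ℕP.+-∸-assoc 1 (ℕP.≤-trans (ℕP.<⇒≤ j<m) (ℕP.m≤m+n m m))))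

module BinomialIdentities where
  open import Data.Nat
  open import Data.Nat.Properties
  open import Data.Nat.Combinatorics
  open import Data.Nat.DivMod using (m/n*n≡m)
  open import Relation.Binary.PropositionalEquality
  open import Data.Nat.Solver
  open +-*-Solver

  C-zero : ∀ n → n C 0 ≡ 1
  C-zero zero    = refl
  C-zero (suc n) = refl

  absorption : ∀ N k → (suc N C suc k) * suc k ≡ suc N * (N C k)
  absorption zero zero = refl
  absorption zero (suc k)
    rewrite k>n⇒nCk≡0 {1} {suc (suc k)} (s≤s (s≤s z≤n)) | k>n⇒nCk≡0 {0} {suc k} (s≤s z≤n) = refl
  absorption (suc N) zero
    rewrite *-identityʳ (suc (suc N) C 1) | nC1≡n (suc (suc N)) | C-zero (suc N) = sym (*-identityʳ (suc (suc N)))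
  absorption (suc N) (suc k) = begin
    (suc (suc N) C suc (suc k)) * suc (suc k)    ≡⟨ cong (_* suc (suc k)) (sym (nCk+nC[k+1]≡[n+1]C[k+1] (suc N) (suc k))) ⟩
    (A + B) * suc (suc k)                        ≡⟨ solve 3 (λ A B k → (A :+ B) :* (con 2 :+ k) := A :* (con 1 :+ k) :+ A :+ B :* (con 2 :+ k)) refl A B k ⟩
    A * suc k + A + B * suc (suc k)              ≡⟨ cong₂ (λ s t → s + A + t) (absorption N k) (absorption N (suc k)) ⟩
    suc N * (N C k) + A + suc N * (N C suc k)    ≡⟨ solve 4 (λ n x A y → (con 1 :+ n) :* x :+ A :+ (con 1 :+ n) :* y := (con 1 :+ n) :* (x :+ y) :+ A) refl N (N C k) A (N C suc k) ⟩
    suc N * ((N C k) + (N C suc k)) + A          ≡⟨ cong (λ t → suc N * t + A) (nCk+nC[k+1]≡[n+1]C[k+1] N k) ⟩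
    suc N * A + A                                ≡⟨ +-comm (suc N * A) A ⟩
    suc (suc N) * A ∎
    where
    open ≡-Reasoning
    A B : ℕ
    A = suc N C suc k
    B = suc N C suc (suc k)

  C-consecutive : ∀ N k → (N C suc k) * suc k ≡ (N C k) * (N ∸ k)
  C-consecutive N k = begin
    X * suc k                          ≡⟨ sym (m+n∸m≡n (Y * suc k) _) ⟩
    Y * suc k + X * suc k ∸ Y * suc k  ≡⟨ cong (_∸ Y * suc k) (sym (*-distribʳ-+ (suc k) Y X)) ⟩
    (Y + X) * suc k ∸ Y * suc k        ≡⟨ cong (λ t → t * suc k ∸ Y * suc k) (nCk+nC[k+1]≡[n+1]C[k+1] N k) ⟩
    (suc N C suc k) * suc k ∸ Y * suc k ≡⟨ cong (_∸ Y * suc k) (absorption N k) ⟩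
    suc N * Y ∸ Y * suc k              ≡⟨ cong (_∸ Y * suc k) (*-comm (suc N) Y) ⟩
    Y * suc N ∸ Y * suc k              ≡⟨ sym (*-distribˡ-∸ Y (suc N) (suc k)) ⟩
    Y * (N ∸ k) ∎
    where
    open ≡-Reasoning
    X Y : ℕ
    X = N C suc k
    Y = N C k

  C-factorial : ∀ n k → k ≤ n → (n C k) * (k ! * (n ∸ k) !) ≡ n !
  C-factorial n k k≤n = trans (cong (_* (k ! * (n ∸ k) !)) (nCk≡n!/k![n-k]! k≤n))
                              (m/n*n≡m {{k !* (n ∸ k) !≢0}} (k![n∸k]!∣n! k≤n))

  -- choosing a+b of a+b+c objects and then a of those equals choosing the a
  -- objects first and then b of the remaining b+c: both count (a+b+c)!/(a!b!c!)
  subset-of-subset : ∀ a b c → ((a + b + c) C (a + b)) * ((a + b) C a) ≡ ((a + b + c) C a) * ((b + c) C b)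
  subset-of-subset a b c = *-cancelʳ-≡ _ _ (a ! * b ! * c !) {{a!b!c!≢0}} (trans (trinomial-left) (sym trinomial-right))
    where
    open ≡-Reasoning
    a!b!c!≢0 : NonZero (a ! * b ! * c !)
    a!b!c!≢0 = m*n≢0 _ _ {{m*n≢0 _ _ {{a !≢0}} {{b !≢0}}}} {{c !≢0}}
    split : ∀ m n → ((m + n) C m) * (m ! * n !) ≡ (m + n) !
    split m n = trans (cong (λ t → ((m + n) C m) * (m ! * t !)) (sym (m+n∸m≡n m n))) (C-factorial (m + n) m (m≤m+n m n))
    trinomial-left : ((a + b + c) C (a + b)) * ((a + b) C a) * (a ! * b ! * c !) ≡ (a + b + c) !
    trinomial-left = begin
      ((a + b + c) C (a + b)) * ((a + b) C a) * (a ! * b ! * c !)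
        ≡⟨ solve 5 (λ x y A B Cc → x :* y :* (A :* B :* Cc) := x :* ((y :* (A :* B)) :* Cc)) refl ((a + b + c) C (a + b)) ((a + b) C a) (a !) (b !) (c !) ⟩
      ((a + b + c) C (a + b)) * (((a + b) C a) * (a ! * b !) * c !) ≡⟨ cong (λ t → ((a + b + c) C (a + b)) * (t * c !)) (split a b) ⟩
      ((a + b + c) C (a + b)) * ((a + b) ! * c !)                    ≡⟨ split (a + b) c ⟩
      (a + b + c) ! ∎
    trinomial-right : ((a + b + c) C a) * ((b + c) C b) * (a ! * b ! * c !) ≡ (a + b + c) !
    trinomial-right = begin
      ((a + b + c) C a) * ((b + c) C b) * (a ! * b ! * c !)
        ≡⟨ solve 5 (λ x y A B Cc → x :* y :* (A :* B :* Cc) := x :* (A :* (y :* (B :* Cc)))) refl ((a + b + c) C a) ((b + c) C b) (a !) (b !) (c !) ⟩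
      ((a + b + c) C a) * (a ! * (((b + c) C b) * (b ! * c !))) ≡⟨ cong (λ t → ((a + b + c) C a) * (a ! * t)) (split b c) ⟩
      ((a + b + c) C a) * (a ! * (b + c) !)                      ≡⟨ cong (λ t → (t C a) * (a ! * (b + c) !)) (+-assoc a b c) ⟩
      ((a + (b + c)) C a) * (a ! * (b + c) !)                    ≡⟨ split a (b + c) ⟩
      (a + (b + c)) !                                            ≡⟨ cong _! (sym (+-assoc a b c)) ⟩
      (a + b + c) ! ∎

  central-C : ∀ n → (2 * suc n) C suc n ≡ 2 * ((suc n + n) C n)
  central-C n = begin
    (2 * suc n) C suc n                           ≡⟨ cong (λ t → suc t C suc n) (trans (cong (n +_) (+-identityʳ (suc n))) (+-suc n n)) ⟩
    suc (suc (n + n)) C suc n                     ≡⟨ sym (nCk+nC[k+1]≡[n+1]C[k+1] (suc (n + n)) n) ⟩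
    (suc (n + n) C n) + (suc (n + n) C suc n)     ≡⟨ cong ((suc (n + n) C n) +_) symmetric ⟩
    (suc (n + n) C n) + (suc (n + n) C n)         ≡⟨ solve 1 (λ x → x :+ x := con 2 :* x) refl (suc (n + n) C n) ⟩
    2 * (suc (n + n) C n) ∎
    where
    open ≡-Reasoning
    symmetric : suc (n + n) C suc n ≡ suc (n + n) C n
    symmetric = trans (nCk≡nC[n∸k] {suc n} {suc (n + n)} (s≤s (m≤m+n n n))) (cong (suc (n + n) C_) (m+n∸m≡n n n))

  central-split : ∀ q d → d ≤ q → ((2 * q) C (q + d)) * ((q + d) C d) ≡ ((2 * q) C q) * (q C d)
  central-split q d d≤q = begin
    ((2 * q) C (q + d)) * ((q + d) C d)                       ≡⟨ cong₂ (λ s t → (s C (q + d)) * t) (sym q+d+[q-d]≡2q) (sym symmetric) ⟩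
    ((q + d + (q ∸ d)) C (q + d)) * ((q + d) C q)             ≡⟨ subset-of-subset q d (q ∸ d) ⟩
    ((q + d + (q ∸ d)) C q) * ((d + (q ∸ d)) C d)             ≡⟨ cong₂ (λ s t → (s C q) * (t C d)) q+d+[q-d]≡2q (m+[n∸m]≡n d≤q) ⟩
    ((2 * q) C q) * (q C d) ∎
    where
    open ≡-Reasoning
    q+d+[q-d]≡2q : q + d + (q ∸ d) ≡ 2 * q
    q+d+[q-d]≡2q = trans (+-assoc q d (q ∸ d)) (cong (q +_) (trans (m+[n∸m]≡n d≤q) (sym (+-identityʳ q))))
    symmetric : (q + d) C q ≡ (q + d) C d
    symmetric = trans (nCk≡nC[n∸k] {q} {q + d} (m≤m+n q d)) (cong ((q + d) C_) (m+n∸m≡n q d))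

  -- Pascal's rule applied twice:
  -- C(2n+2, n+1+e) = C(2n, n+e) + (C(2n, n+e-1) + C(2n, n+e) + C(2n, n+e+1)), here with e = e′+1
  pascal-twice : ∀ n e′ → (2 * suc n) C (suc n + suc e′)
    ≡ (2 * n) C (n + suc e′) + ((2 * n) C (n + e′) + (2 * n) C (n + suc e′) + (2 * n) C (n + suc (suc e′)))
  pascal-twice n e′ = begin
    (2 * suc n) C (suc n + suc e′)              ≡⟨ cong₂ _C_ (*-distribˡ-+ 2 1 n) (cong suc (+-suc n e′)) ⟩
    suc (suc N) C suc (suc K)                   ≡⟨ sym (nCk+nC[k+1]≡[n+1]C[k+1] (suc N) (suc K)) ⟩
    (suc N C suc K) + (suc N C suc (suc K))     ≡⟨ cong₂ _+_ (sym (nCk+nC[k+1]≡[n+1]C[k+1] N K)) (sym (nCk+nC[k+1]≡[n+1]C[k+1] N (suc K))) ⟩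
    ((N C K) + (N C suc K)) + ((N C suc K) + (N C suc (suc K)))
      ≡⟨ solve 4 (λ a b c d → (a :+ b) :+ (c :+ d) := b :+ (a :+ c :+ d)) refl (N C K) (N C suc K) (N C suc K) (N C suc (suc K)) ⟩
    (N C suc K) + ((N C K) + (N C suc K) + (N C suc (suc K)))
      ≡⟨ cong₂ (λ s t → (N C s) + ((N C K) + (N C s) + (N C t))) (sym (+-suc n e′)) (sym (trans (+-suc n (suc e′)) (cong suc (+-suc n e′)))) ⟩
    (2 * n) C (n + suc e′) + ((2 * n) C (n + e′) + (2 * n) C (n + suc e′) + (2 * n) C (n + suc (suc e′))) ∎
    where
    open ≡-Reasoning
    N K : ℕ
    N = 2 * n
    K = n + e′

-- The sum of three consecutive values of F collapses: the Legendre-symbol terms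
-- cancel (three consecutive residues mod 3), S telescopes to one term and the
-- binomial sums add up by Pascal's rule.
module ThreeConsecutive where
  open Embedding
  open FiniteSums
  open BinomialIdentities
  open import Defs
  open import Data.Rational using (ℚ; 0ℚ; 1ℚ; ½; _+_; _-_; _*_)
  open import Data.Rational.Properties using (+-identityˡ; +-identityʳ; *-zeroʳ)
  open import Data.Rational.Solver
  open +-*-Solver
  open import Data.Integer as ℤ using (ℤ; +_)
  import Data.Integer.Properties as ℤP
  open import Data.Nat as ℕ using (ℕ; suc; zero; _∸_; _^_)
  import Data.Nat.Properties as ℕP
  open import Data.Nat.DivMod using (_%_; [m+n]%n≡m%n)
  open import Data.Nat.Combinatorics using (_C_)
  open import Relation.Binary.PropositionalEquality
  open import Data.Product using (_,_)
  open import Function using (_∘_)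

  χ : ℕ → ℚ
  χ n = ℤ→ℚ (leg3 (+ n))

  χ-by-residue : ℕ → ℤ
  χ-by-residue 0 = + 0
  χ-by-residue 1 = + 1
  χ-by-residue _ = ℤ.-[1+ 0 ]

  leg3-residue : ∀ n → leg3 (+ n) ≡ χ-by-residue (n % 3)
  leg3-residue n with n % 3
  ... | 0           = refl
  ... | 1           = refl
  ... | suc (suc _) = refl

  χ-periodic : ∀ n → χ (3 ℕ.+ n) ≡ χ n
  χ-periodic n = cong ℤ→ℚ (trans (leg3-residue (3 ℕ.+ n))
    (trans (cong χ-by-residue (trans (cong (_% 3) (ℕP.+-comm 3 n)) ([m+n]%n≡m%n n 3))) (sym (leg3-residue n))))

  χ-three : ∀ n → χ n + χ (suc n) + χ (suc (suc n)) ≡ 0ℚ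
  χ-three zero    = refl
  χ-three (suc n) = begin
    χ (suc n) + χ (suc (suc n)) + χ (3 ℕ.+ n) ≡⟨ cong (λ t → χ (suc n) + χ (suc (suc n)) + t) (χ-periodic n) ⟩
    χ (suc n) + χ (suc (suc n)) + χ n         ≡⟨ solve 3 (λ a b c → a :+ b :+ c := c :+ a :+ b) refl (χ (suc n)) (χ (suc (suc n))) (χ n) ⟩
    χ n + χ (suc n) + χ (suc (suc n))         ≡⟨ χ-three n ⟩
    0ℚ ∎
    where open ≡-Reasoning

  ℤ-minus : ∀ m j → j ℕ.≤ m → + m ℤ.- + j ≡ + (m ∸ j)
  ℤ-minus m j j≤m = trans (ℤP.m-n≡m⊖n m j) (ℤP.⊖-≥ j≤m)

  χ-reflected-three : ∀ q e → suc (suc e) ℕ.≤ q →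
    ℤ→ℚ (leg3 (+ q ℤ.- + e)) + ℤ→ℚ (leg3 (+ q ℤ.- + suc e)) + ℤ→ℚ (leg3 (+ q ℤ.- + suc (suc e))) ≡ 0ℚ
  χ-reflected-three q e e+2≤q with ℕP.m≤n⇒∃[o]m+o≡n e+2≤q
  ... | m , refl = begin
    χ′ e + χ′ (suc e) + χ′ (suc (suc e))            ≡⟨ cong₂ (λ s t → s + t + χ′ (suc (suc e))) (χ′≡χ e (suc (suc m)) (cong (suc ∘ suc) (ℕP.+-comm e m))) (χ′≡χ (suc e) (suc m) (cong suc (ℕP.+-comm (suc e) m))) ⟩
    χ (suc (suc m)) + χ (suc m) + χ′ (suc (suc e)) ≡⟨ cong (λ t → χ (suc (suc m)) + χ (suc m) + t) (χ′≡χ (suc (suc e)) m (ℕP.+-comm (suc (suc e)) m)) ⟩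
    χ (suc (suc m)) + χ (suc m) + χ m               ≡⟨ solve 3 (λ a b c → a :+ b :+ c := c :+ b :+ a) refl (χ (suc (suc m))) (χ (suc m)) (χ m) ⟩
    χ m + χ (suc m) + χ (suc (suc m))               ≡⟨ χ-three m ⟩
    0ℚ ∎
    where
    open ≡-Reasoning
    χ′ : ℕ → ℚ
    χ′ j = ℤ→ℚ (leg3 (+ q ℤ.- + j))
    χ′≡χ : ∀ j r → q ≡ r ℕ.+ j → χ′ j ≡ χ r
    χ′≡χ j r q≡r+j = cong (λ z → ℤ→ℚ (leg3 z)) (trans (ℤ-minus q j (subst (j ℕ.≤_) (sym q≡r+j) (ℕP.m≤n+m j r)))
                                                         (cong +_ (trans (cong (_∸ j) q≡r+j) (ℕP.m+n∸n≡m r j))))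

  coef : ℕ → ℚ
  coef j = neg1^ j * recip (suc j)

  twisted : ℕ → ℕ → ℚ
  twisted n m = sumℚ n (λ j → coef j * χ (m ∸ j))

  S-as-twisted : ∀ m → S (suc m) ≡ twisted m m
  S-as-twisted m = sum-cong m (λ j j<m → cong (λ t → coef j * ℤ→ℚ (leg3 t)) (ℤ-minus (suc m) (suc j) (ℕ.s≤s (ℕP.<⇒≤ j<m))))

  -- the same with one more (vanishing) term, since (0/3) = 0
  S-as-twisted′ : ∀ e → S e ≡ twisted e (e ∸ 1)
  S-as-twisted′ zero    = refl
  S-as-twisted′ (suc m) = trans (S-as-twisted m) (trans (sym (+-identityʳ _)) (cong (_+_ (twisted m m)) (sym last-term)))
    where
    last-term : coef m * χ (m ∸ m) ≡ 0ℚ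
    last-term = trans (cong (λ t → coef m * χ t) (ℕP.n∸n≡0 m)) (*-zeroʳ (coef m))

  -- S(e) + S(e+1) + S(e+2) = (-1)^e/(e+1): all other terms cancel in threes
  S-three : ∀ e → S e + S (suc e) + S (suc (suc e)) ≡ coef e
  S-three e = begin
    S e + S (suc e) + S (suc (suc e))
      ≡⟨ cong₂ (λ a b → a + b + S (suc (suc e))) (S-as-twisted′ e) (S-as-twisted e) ⟩
    twisted e (e ∸ 1) + twisted e e + S (suc (suc e))
      ≡⟨ cong (λ t → twisted e (e ∸ 1) + twisted e e + t) (S-as-twisted (suc e)) ⟩
    twisted e (e ∸ 1) + twisted e e + (twisted e (suc e) + coef e * χ (suc e ∸ e))
      ≡⟨ cong (λ t → twisted e (e ∸ 1) + twisted e e + (twisted e (suc e) + coef e * χ t)) (ℕP.m+n∸n≡m 1 e) ⟩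
    twisted e (e ∸ 1) + twisted e e + (twisted e (suc e) + coef e * 1ℚ)
      ≡⟨ solve 4 (λ a b c s → a :+ b :+ (c :+ s :* con 1ℚ) := (a :+ b :+ c) :+ s) refl (twisted e (e ∸ 1)) (twisted e e) (twisted e (suc e)) (coef e) ⟩
    twisted e (e ∸ 1) + twisted e e + twisted e (suc e) + coef e
      ≡⟨ cong (_+ coef e) cancel ⟩
    0ℚ + coef e
      ≡⟨ +-identityˡ (coef e) ⟩
    coef e ∎
    where
    open ≡-Reasoning
    term : ℕ → ℕ → ℚ
    term m j = coef j * χ (m ∸ j)
    cancel : twisted e (e ∸ 1) + twisted e e + twisted e (suc e) ≡ 0ℚ
    cancel = begin
      twisted e (e ∸ 1) + twisted e e + twisted e (suc e)   ≡⟨ cong (_+ twisted e (suc e)) (sym (sum-+ e (term (e ∸ 1)) (term e))) ⟩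
      sumℚ e (λ j → term (e ∸ 1) j + term e j) + twisted e (suc e) ≡⟨ sym (sum-+ e (λ j → term (e ∸ 1) j + term e j) (term (suc e))) ⟩
      sumℚ e (λ j → term (e ∸ 1) j + term e j + term (suc e) j)  ≡⟨ sum-zero e _ pointwise ⟩
      0ℚ ∎
      where
      pointwise : ∀ j → j ℕ.< e → term (e ∸ 1) j + term e j + term (suc e) j ≡ 0ℚ
      pointwise j j<e = begin
        term (e ∸ 1) j + term e j + term (suc e) j
          ≡⟨ solve 4 (λ c x y z → c :* x :+ c :* y :+ c :* z := c :* (x :+ y :+ z)) refl (coef j) (χ m) (χ (e ∸ j)) (χ (suc e ∸ j)) ⟩
        coef j * (χ m + χ (e ∸ j) + χ (suc e ∸ j))
          ≡⟨ cong₂ (λ s t → coef j * (χ m + χ s + χ t)) e∸j (trans (ℕP.+-∸-assoc 1 (ℕP.<⇒≤ j<e)) (cong suc e∸j)) ⟩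
        coef j * (χ m + χ (suc m) + χ (suc (suc m)))
          ≡⟨ cong (coef j *_) (χ-three m) ⟩
        coef j * 0ℚ
          ≡⟨ *-zeroʳ (coef j) ⟩
        0ℚ ∎
        where
        m : ℕ
        m = (e ∸ 1) ∸ j
        e∸j : e ∸ j ≡ suc m
        e∸j = predecessor-gap e j<e
          where
          predecessor-gap : ∀ n → j ℕ.< n → n ∸ j ≡ suc ((n ∸ 1) ∸ j)
          predecessor-gap (suc n) (ℕ.s≤s j≤n) = ℕP.+-∸-assoc 1 j≤n

  binomial-sum : ℕ → ℕ → ℚ
  binomial-sum e n = sumℚ n (λ k → ℕ→ℚ ((2 ℕ.* k) C (k ℕ.+ e)))

  binomial-sum-three : ∀ n e → binomial-sum e n + binomial-sum (suc e) n + binomial-sum (suc (suc e)) n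
                              ≡ ℕ→ℚ ((2 ℕ.* n) C (n ℕ.+ suc e))
  binomial-sum-three zero    e = refl
  binomial-sum-three (suc n) e = begin
    (binomial-sum e n + c₀) + (binomial-sum (suc e) n + c₁) + (binomial-sum (suc (suc e)) n + c₂)
      ≡⟨ solve 6 (λ a b c x y z → (a :+ x) :+ (b :+ y) :+ (c :+ z) := (a :+ b :+ c) :+ (x :+ y :+ z)) refl
           (binomial-sum e n) (binomial-sum (suc e) n) (binomial-sum (suc (suc e)) n) c₀ c₁ c₂ ⟩
    (binomial-sum e n + binomial-sum (suc e) n + binomial-sum (suc (suc e)) n) + (c₀ + c₁ + c₂)
      ≡⟨ cong (_+ (c₀ + c₁ + c₂)) (binomial-sum-three n e) ⟩
    c₁ + (c₀ + c₁ + c₂)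
      ≡⟨ sym (trans (ℕ→ℚ-+ b₁ (b₀ ℕ.+ b₁ ℕ.+ b₂)) (cong (_+_ c₁) (trans (ℕ→ℚ-+ (b₀ ℕ.+ b₁) b₂) (cong (_+ c₂) (ℕ→ℚ-+ b₀ b₁))))) ⟩
    ℕ→ℚ (b₁ ℕ.+ (b₀ ℕ.+ b₁ ℕ.+ b₂))
      ≡⟨ cong ℕ→ℚ (sym (pascal-twice n e)) ⟩
    ℕ→ℚ ((2 ℕ.* suc n) C (suc n ℕ.+ suc e)) ∎
    where
    open ≡-Reasoning
    b₀ b₁ b₂ : ℕ
    b₀ = (2 ℕ.* n) C (n ℕ.+ e)
    b₁ = (2 ℕ.* n) C (n ℕ.+ suc e)
    b₂ = (2 ℕ.* n) C (n ℕ.+ suc (suc e))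
    c₀ c₁ c₂ : ℚ
    c₀ = ℕ→ℚ b₀
    c₁ = ℕ→ℚ b₁
    c₂ = ℕ→ℚ b₂

  F-three : ∀ p a e → suc (suc e) ℕ.≤ p ^ a →
    F p a e + F p a (suc e) + F p a (suc (suc e)) ≡ ½ * ℕ→ℚ ((2 ℕ.* p ^ a) C (p ^ a ℕ.+ suc e)) + neg1^ p * ℕ→ℚ (p ^ a) * coef e
  F-three p a e e+2≤q = begin
    F p a e + F p a (suc e) + F p a (suc (suc e))
      ≡⟨ solve 17 (λ h g₀ g₁ g₂ l₀ l₁ l₂ s Q s₀ s₁ s₂ P I m₀ m₁ m₂ →
            (h :* (g₀ :- l₀) :+ s :* Q :* s₀ :- P :* I :* m₀) :+ (h :* (g₁ :- l₁) :+ s :* Q :* s₁ :- P :* I :* m₁) :+ (h :* (g₂ :- l₂) :+ s :* Q :* s₂ :- P :* I :* m₂)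
            := h :* (g₀ :+ g₁ :+ g₂) :- h :* (l₀ :+ l₁ :+ l₂) :+ s :* Q :* (s₀ :+ s₁ :+ s₂) :- P :* I :* (m₀ :+ m₁ :+ m₂)) refl
           ½ (binomial-sum e q) (binomial-sum (suc e) q) (binomial-sum (suc (suc e)) q) (χ′ e) (χ′ (suc e)) (χ′ (suc (suc e)))
           (neg1^ p) (ℕ→ℚ q) (S e) (S (suc e)) (S (suc (suc e))) (ℕ→ℚ p) (iv3 p) (χ e) (χ (suc e)) (χ (suc (suc e))) ⟩
    ½ * (binomial-sum e q + binomial-sum (suc e) q + binomial-sum (suc (suc e)) q) - ½ * (χ′ e + χ′ (suc e) + χ′ (suc (suc e)))
      + neg1^ p * ℕ→ℚ q * (S e + S (suc e) + S (suc (suc e))) - ℕ→ℚ p * iv3 p * (χ e + χ (suc e) + χ (suc (suc e)))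
      ≡⟨ cong₂ (λ u v → ½ * u - ½ * v + neg1^ p * ℕ→ℚ q * (S e + S (suc e) + S (suc (suc e))) - ℕ→ℚ p * iv3 p * (χ e + χ (suc e) + χ (suc (suc e))))
               (binomial-sum-three q e) (χ-reflected-three q e e+2≤q) ⟩
    ½ * G - ½ * 0ℚ + neg1^ p * ℕ→ℚ q * (S e + S (suc e) + S (suc (suc e))) - ℕ→ℚ p * iv3 p * (χ e + χ (suc e) + χ (suc (suc e)))
      ≡⟨ cong₂ (λ u v → ½ * G - ½ * 0ℚ + neg1^ p * ℕ→ℚ q * u - ℕ→ℚ p * iv3 p * v) (S-three e) (χ-three e) ⟩
    ½ * G - ½ * 0ℚ + neg1^ p * ℕ→ℚ q * coef e - ℕ→ℚ p * iv3 p * 0ℚ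
      ≡⟨ solve 6 (λ h G s Q c P → h :* G :- h :* con 0ℚ :+ s :* Q :* c :- P :* con 0ℚ := h :* G :+ s :* Q :* c) refl ½ G (neg1^ p) (ℕ→ℚ q) (coef e) (ℕ→ℚ p * iv3 p) ⟩
    ½ * G + neg1^ p * ℕ→ℚ q * coef e ∎
    where
    open ≡-Reasoning
    q : ℕ
    q = p ^ a
    G : ℚ
    G = ℕ→ℚ ((2 ℕ.* q) C (q ℕ.+ suc e))
    χ′ : ℕ → ℚ
    χ′ j = ℤ→ℚ (leg3 (+ q ℤ.- + j))

module Parity where
  open Embedding
  open import Defs
  open import Data.Rational using (1ℚ; -_)
  open import Data.Nat as ℕ using (ℕ; suc; zero; _^_)
  import Data.Nat.Properties as ℕP
  open import Data.Nat.Divisibility using (divides)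
  open import Data.Nat.Primality using (Prime; prime⇒irreducible)
  open import Data.Product using (∃; _,_)
  open import Data.Sum using (_⊎_; inj₁; inj₂)
  open import Relation.Binary.PropositionalEquality
  import Data.Nat.Solver
  open Data.Nat.Solver.+-*-Solver

  Even Odd : ℕ → Set
  Even n = ∃ λ m → n ≡ m ℕ.+ m
  Odd  n = ∃ λ m → n ≡ suc (m ℕ.+ m)

  parity : ∀ n → Even n ⊎ Odd n
  parity zero = inj₁ (0 , refl)
  parity (suc n) with parity n
  ... | inj₁ (m , refl) = inj₂ (m , refl)
  ... | inj₂ (m , refl) = inj₁ (suc m , cong suc (sym (ℕP.+-suc m m)))

  odd-* : ∀ {m n} → Odd m → Odd n → Odd (m ℕ.* n)
  odd-* (a , refl) (b , refl) = a ℕ.+ b ℕ.* suc (a ℕ.+ a) ,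
    solve 2 (λ a b → (con 1 :+ (a :+ a)) :* (con 1 :+ (b :+ b))
                  := con 1 :+ ((a :+ b :* (con 1 :+ (a :+ a))) :+ (a :+ b :* (con 1 :+ (a :+ a))))) refl a b

  odd-^ : ∀ {m} → Odd m → ∀ a → Odd (m ^ a)
  odd-^ odd zero    = 0 , refl
  odd-^ odd (suc a) = odd-* odd (odd-^ odd a)

  even-^ : ∀ {m} → Even m → ∀ a → Even (m ^ suc a)
  even-^ {m} (h , refl) a = h ℕ.* m ^ a , ℕP.*-distribʳ-+ (m ^ a) h h

  neg1^-even : ∀ m → neg1^ (m ℕ.+ m) ≡ 1ℚ
  neg1^-even m = trans (neg1^-+ m m) (neg1^-square m)

  neg1^-odd : ∀ m → neg1^ (suc (m ℕ.+ m)) ≡ - 1ℚ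
  neg1^-odd m = cong -_ (neg1^-even m)

  -- (-1)^(n^(a+1)) = (-1)^n, as n^(a+1) and n have the same parity
  neg1^-power : ∀ n a → neg1^ (n ^ suc a) ≡ neg1^ n
  neg1^-power n a with parity n
  ... | inj₁ even@(m , refl) = let (h , n^a+1≡h+h) = even-^ even a in
    trans (cong neg1^ n^a+1≡h+h) (trans (neg1^-even h) (sym (neg1^-even m)))
  ... | inj₂ odd@(m , refl) = let (h , n^a+1≡1+h+h) = odd-^ odd (suc a) in
    trans (cong neg1^ n^a+1≡1+h+h) (trans (neg1^-odd h) (sym (neg1^-odd m)))

  even-prime : ∀ {p} → Prime p → Even p → p ≡ 2
  even-prime pr (m , p≡m+m) with prime⇒irreducible pr (divides m (trans p≡m+m (solve 1 (λ m → m :+ m := m :* con 2) refl m)))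
  ... | inj₁ ()
  ... | inj₂ 2≡p = sym 2≡p

  prime-parity : ∀ {p} → Prime p → p ≡ 2 ⊎ Odd p
  prime-parity {p} pr with parity p
  ... | inj₁ even = inj₁ (even-prime pr even)
  ... | inj₂ odd  = inj₂ odd

module PAdic (p : ℕ) (pr : Prime p) where
  open Embedding
  open FiniteSums
  open import Defs
  open import Data.Rational using (ℚ; 0ℚ; 1ℚ; _+_; _-_; _*_; -_; mkℚ; ↥_; ↧_; ↧ₙ_; toℚᵘ)
  open import Data.Rational.Properties using (toℚᵘ-homo-*; toℚᵘ-cong; *-identityˡ; *-identityʳ; *-zeroʳ; *-comm; +-inverseʳ)
  import Data.Rational.Unnormalised as U
  import Data.Rational.Unnormalised.Properties as UP
  open import Data.Rational.Solver
  open +-*-Solver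
  open import Data.Integer as ℤ using (ℤ; +_)
  import Data.Integer.Properties as ℤP
  import Data.Integer.Divisibility.Signed as ℤ∣
  open import Data.Nat as ℕ using (ℕ; suc; zero; _^_)
  import Data.Nat.Properties as ℕP
  open import Data.Nat.Divisibility using (_∣_; _∣?_; ∣-trans; divides; ∣1⇒≡1)
  open import Data.Nat.Primality using (Prime; euclidsLemma; ¬prime[1]; prime⇒nonZero)
  import Data.Nat.Coprimality as Coprimality
  open import Data.Product using (_,_)
  open import Data.Sum using (inj₁; inj₂)
  open import Relation.Nullary using (¬_; yes; no)
  open import Relation.Binary.PropositionalEquality

  instance
    p≢0 : ℕ.NonZero p
    p≢0 = prime⇒nonZero pr

  p∤1 : ¬ p ∣ 1
  p∤1 p∣1 with ∣1⇒≡1 p∣1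
  ... | refl = ¬prime[1] pr

  p∤-* : ∀ {a b} → ¬ p ∣ ℤ.∣ a ∣ → ¬ p ∣ ℤ.∣ b ∣ → ¬ p ∣ ℤ.∣ a ℤ.* b ∣
  p∤-* {a} {b} p∤a p∤b p∣ab with euclidsLemma _ _ pr (subst (p ∣_) (ℤP.abs-* a b) p∣ab)
  ... | inj₁ p∣a = p∤a p∣a
  ... | inj₂ p∣b = p∤b p∣b

  record Integral (x : ℚ) : Set where
    constructor integral
    field
      numer denom    : ℤ
      p∤denom        : ¬ p ∣ ℤ.∣ denom ∣
      denom-clears-x : x * ℤ→ℚ denom ≡ ℤ→ℚ numer

  -- then the reduced denominator of x divides m, so it is prime to p as well
  integral⇒denominator : ∀ z → Integral z → ¬ p ∣ ↧ₙ z
  integral⇒denominator z@(mkℚ _ _ coprime) (integral n m p∤m zm≡n) p∣den = p∤m (∣-trans p∣den den∣m)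
    where
    cross : ↥ z ℤ.* m ℤ.* + 1 ≡ n ℤ.* (↧ z ℤ.* + 1)
    cross = UP.drop-*≡* (UP.≃-trans (UP.≃-sym (UP.≃-trans (toℚᵘ-homo-* z (ℤ→ℚ m)) (UP.*-cong (UP.≃-refl {toℚᵘ z}) (toℚᵘ-ℤ→ℚ m))))
                  (UP.≃-trans (toℚᵘ-cong zm≡n) (toℚᵘ-ℤ→ℚ n)))
    cross-abs : ℤ.∣ ↥ z ∣ ℕ.* ℤ.∣ m ∣ ≡ ℤ.∣ n ∣ ℕ.* ↧ₙ z
    cross-abs = trans (sym (ℤP.abs-* (↥ z) m))
      (trans (cong ℤ.∣_∣ (trans (sym (ℤP.*-identityʳ (↥ z ℤ.* m))) (trans cross (cong (n ℤ.*_) (ℤP.*-identityʳ (↧ z)))))) (ℤP.abs-* n (↧ z)))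
    den∣m : ↧ₙ z ∣ ℤ.∣ m ∣
    den∣m = Coprimality.coprime-divisor (Coprimality.sym (Coprimality.recompute coprime)) (divides ℤ.∣ n ∣ cross-abs)

  integral-ℤ : ∀ i → Integral (ℤ→ℚ i)
  integral-ℤ i = integral i (+ 1) p∤1 (*-identityʳ (ℤ→ℚ i))

  integral-ℕ : ∀ n → Integral (ℕ→ℚ n)
  integral-ℕ n = integral-ℤ (+ n)

  integral-+ : ∀ {x y} → Integral x → Integral y → Integral (x + y)
  integral-+ {x} {y} (integral n₁ m₁ p∤m₁ e₁) (integral n₂ m₂ p∤m₂ e₂) =
    integral (n₁ ℤ.* m₂ ℤ.+ n₂ ℤ.* m₁) (m₁ ℤ.* m₂) (p∤-* {m₁} {m₂} p∤m₁ p∤m₂) (begin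
      (x + y) * ℤ→ℚ (m₁ ℤ.* m₂)                          ≡⟨ cong ((x + y) *_) (ℤ→ℚ-* m₁ m₂) ⟩
      (x + y) * (ℤ→ℚ m₁ * ℤ→ℚ m₂)                        ≡⟨ solve 4 (λ x y a b → (x :+ y) :* (a :* b) := (x :* a) :* b :+ (y :* b) :* a) refl x y (ℤ→ℚ m₁) (ℤ→ℚ m₂) ⟩
      (x * ℤ→ℚ m₁) * ℤ→ℚ m₂ + (y * ℤ→ℚ m₂) * ℤ→ℚ m₁      ≡⟨ cong₂ (λ s t → s * ℤ→ℚ m₂ + t * ℤ→ℚ m₁) e₁ e₂ ⟩
      ℤ→ℚ n₁ * ℤ→ℚ m₂ + ℤ→ℚ n₂ * ℤ→ℚ m₁                  ≡⟨ sym (cong₂ _+_ (ℤ→ℚ-* n₁ m₂) (ℤ→ℚ-* n₂ m₁)) ⟩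
      ℤ→ℚ (n₁ ℤ.* m₂) + ℤ→ℚ (n₂ ℤ.* m₁)                  ≡⟨ sym (ℤ→ℚ-+ (n₁ ℤ.* m₂) (n₂ ℤ.* m₁)) ⟩
      ℤ→ℚ (n₁ ℤ.* m₂ ℤ.+ n₂ ℤ.* m₁) ∎)
    where open ≡-Reasoning

  integral-* : ∀ {x y} → Integral x → Integral y → Integral (x * y)
  integral-* {x} {y} (integral n₁ m₁ p∤m₁ e₁) (integral n₂ m₂ p∤m₂ e₂) =
    integral (n₁ ℤ.* n₂) (m₁ ℤ.* m₂) (p∤-* {m₁} {m₂} p∤m₁ p∤m₂) (begin
      (x * y) * ℤ→ℚ (m₁ ℤ.* m₂)        ≡⟨ cong ((x * y) *_) (ℤ→ℚ-* m₁ m₂) ⟩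
      (x * y) * (ℤ→ℚ m₁ * ℤ→ℚ m₂)      ≡⟨ solve 4 (λ x y a b → (x :* y) :* (a :* b) := (x :* a) :* (y :* b)) refl x y (ℤ→ℚ m₁) (ℤ→ℚ m₂) ⟩
      (x * ℤ→ℚ m₁) * (y * ℤ→ℚ m₂)      ≡⟨ cong₂ _*_ e₁ e₂ ⟩
      ℤ→ℚ n₁ * ℤ→ℚ n₂                  ≡⟨ sym (ℤ→ℚ-* n₁ n₂) ⟩
      ℤ→ℚ (n₁ ℤ.* n₂) ∎)
    where open ≡-Reasoning

  integral-neg : ∀ {x} → Integral x → Integral (- x)
  integral-neg {x} x-int = subst Integral (solve 1 (λ x → con (- 1ℚ) :* x := :- x) refl x) (integral-* (integral-ℤ (ℤ.- + 1)) x-int)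

  integral-neg1^ : ∀ n → Integral (neg1^ n)
  integral-neg1^ zero    = integral-ℤ (+ 1)
  integral-neg1^ (suc n) = integral-neg (integral-neg1^ n)

  integral-recip : ∀ i → .{{ℕ.NonZero i}} → ¬ p ∣ i → Integral (recip i)
  integral-recip i p∤i = integral (+ 1) (+ i) p∤i recip-inverse′
    where
    recip-inverse′ : recip i * ℕ→ℚ i ≡ ℤ→ℚ (+ 1)
    recip-inverse′ = trans (solve 2 (λ r n → r :* n := n :* r) refl (recip i) (ℕ→ℚ i)) (recip-inverse i)

  π^ : ℕ → ℚ
  π^ k = ℕ→ℚ (p ^ k)

  π^-+ : ∀ j k → π^ (j ℕ.+ k) ≡ π^ j * π^ k
  π^-+ j k = trans (cong ℕ→ℚ (ℕP.^-distribˡ-+-* p j k)) (ℕ→ℚ-* (p ^ j) (p ^ k))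

  π^-1 : π^ 1 ≡ ℕ→ℚ p
  π^-1 = cong ℕ→ℚ (ℕP.*-identityʳ p)

  record Divisible (k : ℕ) (x : ℚ) : Set where
    constructor divisible
    field
      quotient          : ℚ
      quotient-integral : Integral quotient
      factorisation     : x ≡ π^ k * quotient

  divisible-zero : ∀ k → Divisible k 0ℚ
  divisible-zero k = divisible 0ℚ (integral-ℤ (+ 0)) (sym (*-zeroʳ (π^ k)))

  divisible-+ : ∀ {k x y} → Divisible k x → Divisible k y → Divisible k (x + y)
  divisible-+ {k} (divisible z₁ z₁-int refl) (divisible z₂ z₂-int refl) = divisible (z₁ + z₂) (integral-+ z₁-int z₂-int)
    (solve 3 (λ P a b → P :* a :+ P :* b := P :* (a :+ b)) refl (π^ k) z₁ z₂)

  divisible-neg : ∀ {k x} → Divisible k x → Divisible k (- x)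
  divisible-neg {k} (divisible z z-int refl) = divisible (- z) (integral-neg z-int) (solve 2 (λ P a → :- (P :* a) := P :* (:- a)) refl (π^ k) z)

  divisible-* : ∀ {j k x y} → Divisible j x → Divisible k y → Divisible (j ℕ.+ k) (x * y)
  divisible-* {j} {k} (divisible z₁ z₁-int refl) (divisible z₂ z₂-int refl) = divisible (z₁ * z₂) (integral-* z₁-int z₂-int)
    (trans (solve 4 (λ P Q a b → (P :* a) :* (Q :* b) := (P :* Q) :* (a :* b)) refl (π^ j) (π^ k) z₁ z₂)
           (cong (_* (z₁ * z₂)) (sym (π^-+ j k))))

  divisible-*-integral : ∀ {k x y} → Divisible k x → Integral y → Divisible k (x * y)
  divisible-*-integral {k} {y = y} (divisible z z-int refl) y-int = divisible (z * y) (integral-* z-int y-int)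
    (solve 3 (λ P a b → (P :* a) :* b := P :* (a :* b)) refl (π^ k) z y)

  divisible⇒integral : ∀ {k x} → Divisible k x → Integral x
  divisible⇒integral {k} (divisible z z-int refl) = integral-* (integral-ℕ (p ^ k)) z-int

  divisible⇒congruent : ∀ {k x y t} → x - y ≡ t → Divisible k t → x ≡ y [mod p ^ k ]
  divisible⇒congruent refl (divisible z z-int x-y≡pᵏz) = z , x-y≡pᵏz , integral⇒denominator z z-int

  OneMod : ℕ → ℚ → Set
  OneMod k u = Divisible k (u - 1ℚ)

  one-mod-* : ∀ {k u v} → OneMod k u → OneMod k v → OneMod k (u * v)
  one-mod-* {k} {u} {v} u≡1 v≡1 =
    subst (Divisible k) (solve 2 (λ u v → (u :- con 1ℚ) :* v :+ (v :- con 1ℚ) := u :* v :- con 1ℚ) refl u v)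
      (divisible-+ (divisible-*-integral u≡1 v-int) v≡1)
    where
    v-int : Integral v
    v-int = subst Integral (solve 1 (λ v → (v :- con 1ℚ) :+ con 1ℚ := v) refl v) (integral-+ (divisible⇒integral v≡1) (integral-ℤ (+ 1)))

  prod-one-mod : ∀ k n f → (∀ j → j ℕ.< n → OneMod k (f j)) → OneMod k (prodℚ n f)
  prod-one-mod k zero    f f≡1 = subst (Divisible k) (sym (+-inverseʳ 1ℚ)) (divisible-zero k)
  prod-one-mod k (suc n) f f≡1 = one-mod-* {k} {prodℚ n f} {f n} (prod-one-mod k n f (λ j j<n → f≡1 j (ℕP.m<n⇒m<1+n j<n))) (f≡1 n ℕP.≤-refl)

  divisible-weaken : ∀ {k x} → Divisible (suc k) x → Divisible k x
  divisible-weaken {k} (divisible z z-int refl) = divisible (ℕ→ℚ p * z) (integral-* (integral-ℕ p) z-int)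
    (trans (cong (_* z) (ℕ→ℚ-* p (p ^ k))) (solve 3 (λ P Q z → (P :* Q) :* z := Q :* (P :* z)) refl (ℕ→ℚ p) (π^ k) z))

  -- Writing β = B - 1 and μ = M - 1,
  --   MY - 2BM - εB = M (Y - (2+ε)) - 2βμ + ε ((BM - 1) - βμ) - β · 2(1+ε),
  -- and every term on the right is divisible by p².
  combination-mod-p² : ∀ {B M Y ε} → Integral ε → OneMod 1 B → OneMod 1 M → OneMod 2 (B * M) →
    Divisible 2 (Y - (ℕ→ℚ 2 + ε)) → Divisible 1 (ℕ→ℚ 2 * (1ℚ + ε)) → Divisible 2 (M * Y - ℕ→ℚ 2 * B * M - ε * B)
  combination-mod-p² {B} {M} {Y} {ε} ε-int B≡1 M≡1 BM≡1 Y≡2+ε p∣2[1+ε] =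
    subst (Divisible 2) identity
      (divisible-+ (divisible-+ (divisible-+ (subst (Divisible 2) (*-comm (Y - (ℕ→ℚ 2 + ε)) M) (divisible-*-integral Y≡2+ε M-int))
                                             (divisible-neg (subst (Divisible 2) (*-comm ((B - 1ℚ) * (M - 1ℚ)) (ℕ→ℚ 2)) (divisible-*-integral βμ (integral-ℕ 2)))))
                                (subst (Divisible 2) (*-comm _ ε) (divisible-*-integral (divisible-+ BM≡1 (divisible-neg βμ)) ε-int)))
                   (divisible-neg (divisible-* B≡1 p∣2[1+ε])))
    where
    βμ : Divisible 2 ((B - 1ℚ) * (M - 1ℚ))
    βμ = divisible-* B≡1 M≡1
    M-int : Integral M
    M-int = subst Integral (solve 1 (λ M → (M :- con 1ℚ) :+ con 1ℚ := M) refl M) (integral-+ (divisible⇒integral M≡1) (integral-ℤ (+ 1)))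
    identity : M * (Y - (ℕ→ℚ 2 + ε)) + - (ℕ→ℚ 2 * ((B - 1ℚ) * (M - 1ℚ))) + ε * ((B * M - 1ℚ) + - ((B - 1ℚ) * (M - 1ℚ)))
               + - ((B - 1ℚ) * (ℕ→ℚ 2 * (1ℚ + ε))) ≡ M * Y - ℕ→ℚ 2 * B * M - ε * B
    identity = solve 4 (λ B M Y ε → M :* (Y :- (con (ℕ→ℚ 2) :+ ε)) :+ :- (con (ℕ→ℚ 2) :* ((B :- con 1ℚ) :* (M :- con 1ℚ)))
                                    :+ ε :* ((B :* M :- con 1ℚ) :+ :- ((B :- con 1ℚ) :* (M :- con 1ℚ)))
                                    :+ :- ((B :- con 1ℚ) :* (con (ℕ→ℚ 2) :* (con 1ℚ :+ ε)))
                                    := M :* Y :- con (ℕ→ℚ 2) :* B :* M :- ε :* B) refl B M Y ε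

  -- Under the same kind of hypotheses modulo p:  M′Y + εB ≡ 2(1+ε) ≡ 0 (mod p), since
  --   M′Y + εB = (M′ - 1) Y + (Y - (2+ε)) + ε (B - 1) + 2(1+ε).
  combination-mod-p : ∀ {B M′ Y ε} → Integral ε → OneMod 1 B → OneMod 1 M′ →
    Divisible 2 (Y - (ℕ→ℚ 2 + ε)) → Divisible 1 (ℕ→ℚ 2 * (1ℚ + ε)) → Divisible 1 (M′ * Y + ε * B)
  combination-mod-p {B} {M′} {Y} {ε} ε-int B≡1 M′≡1 Y≡2+ε p∣2[1+ε] =
    subst (Divisible 1) identity
      (divisible-+ (divisible-+ (divisible-+ (divisible-*-integral M′≡1 Y-int) (divisible-weaken Y≡2+ε))
                                (subst (Divisible 1) (*-comm (B - 1ℚ) ε) (divisible-*-integral B≡1 ε-int)))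
                   p∣2[1+ε])
    where
    Y-int : Integral Y
    Y-int = subst Integral (solve 2 (λ Y ε → (Y :- (con (ℕ→ℚ 2) :+ ε)) :+ (con (ℕ→ℚ 2) :+ ε) := Y) refl Y ε)
                  (integral-+ (divisible⇒integral Y≡2+ε) (integral-+ (integral-ℕ 2) ε-int))
    identity : (M′ - 1ℚ) * Y + (Y - (ℕ→ℚ 2 + ε)) + ε * (B - 1ℚ) + ℕ→ℚ 2 * (1ℚ + ε) ≡ M′ * Y + ε * B
    identity = solve 4 (λ B M Y ε → (M :- con 1ℚ) :* Y :+ (Y :- (con (ℕ→ℚ 2) :+ ε)) :+ ε :* (B :- con 1ℚ) :+ con (ℕ→ℚ 2) :* (con 1ℚ :+ ε)
                                    := M :* Y :+ ε :* B) refl B M′ Y ε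

  integral-÷-unit : ∀ {u w v} → OneMod 1 u → w * u ≡ v → Integral v → Integral w
  integral-÷-unit {u} {w} {v} (divisible z (integral n m p∤m zm≡n) u-1≡pz) wu≡v (integral nᵥ mᵥ p∤mᵥ vmᵥ≡nᵥ) =
    integral (nᵥ ℤ.* m) (N ℤ.* mᵥ) (p∤-* {N} {mᵥ} p∤N p∤mᵥ) (begin
      w * ℤ→ℚ (N ℤ.* mᵥ)                ≡⟨ cong (w *_) (trans (ℤ→ℚ-* N mᵥ) (cong (_* ℤ→ℚ mᵥ) N≡um)) ⟩
      w * (u * ℤ→ℚ m * ℤ→ℚ mᵥ)          ≡⟨ solve 4 (λ w u a b → w :* (u :* a :* b) := (w :* u) :* b :* a) refl w u (ℤ→ℚ m) (ℤ→ℚ mᵥ) ⟩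
      (w * u) * ℤ→ℚ mᵥ * ℤ→ℚ m          ≡⟨ cong (λ t → t * ℤ→ℚ mᵥ * ℤ→ℚ m) wu≡v ⟩
      v * ℤ→ℚ mᵥ * ℤ→ℚ m                ≡⟨ cong (_* ℤ→ℚ m) vmᵥ≡nᵥ ⟩
      ℤ→ℚ nᵥ * ℤ→ℚ m                    ≡⟨ sym (ℤ→ℚ-* nᵥ m) ⟩
      ℤ→ℚ (nᵥ ℤ.* m) ∎)
    where
    open ≡-Reasoning
    -- u = 1 + p n/m, so u m = m + p n =: N, which is prime to p
    N : ℤ
    N = m ℤ.+ + p ℤ.* n
    p∤N : ¬ p ∣ ℤ.∣ N ∣
    p∤N p∣N = p∤m (ℤ∣.∣⇒∣ᵤ {+ p} {m} (ℤ∣.∣m+n∣n⇒∣m (ℤ∣.∣ᵤ⇒∣ {+ p} {N} p∣N) (ℤ∣.∣m⇒∣m*n n ℤ∣.∣-refl)))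
    N≡um : ℤ→ℚ N ≡ u * ℤ→ℚ m
    N≡um = begin
      ℤ→ℚ N                              ≡⟨ trans (ℤ→ℚ-+ m (+ p ℤ.* n)) (cong (_+_ (ℤ→ℚ m)) (ℤ→ℚ-* (+ p) n)) ⟩
      ℤ→ℚ m + ℕ→ℚ p * ℤ→ℚ n              ≡⟨ cong (λ t → ℤ→ℚ m + ℕ→ℚ p * t) (sym zm≡n) ⟩
      ℤ→ℚ m + ℕ→ℚ p * (z * ℤ→ℚ m)        ≡⟨ solve 3 (λ m P z → m :+ P :* (z :* m) := (con 1ℚ :+ P :* z) :* m) refl (ℤ→ℚ m) (ℕ→ℚ p) z ⟩
      (1ℚ + ℕ→ℚ p * z) * ℤ→ℚ m           ≡⟨ cong (λ t → (1ℚ + t * z) * ℤ→ℚ m) (sym (cong ℕ→ℚ (ℕP.*-identityʳ p))) ⟩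
      (1ℚ + π^ 1 * z) * ℤ→ℚ m            ≡⟨ cong (_* ℤ→ℚ m) (trans (cong (_+_ 1ℚ) (sym u-1≡pz)) (solve 1 (λ u → con 1ℚ :+ (u :- con 1ℚ) := u) refl u)) ⟩
      u * ℤ→ℚ m ∎

  divisible-÷-unit : ∀ {k u w v} → OneMod 1 u → w * u ≡ v → Divisible k v → Divisible k w
  divisible-÷-unit {k} {u} {w} u≡1 wu≡v (divisible z z-int refl) =
    divisible (w * recip (p ^ k)) (integral-÷-unit u≡1 w/pᵏ·u≡z z-int) (sym pᵏ·w/pᵏ≡w)
    where
    open ≡-Reasoning
    instance
      pᵏ≢0 : ℕ.NonZero (p ^ k)
      pᵏ≢0 = ℕP.m^n≢0 p k
    pᵏ·w/pᵏ≡w : π^ k * (w * recip (p ^ k)) ≡ w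
    pᵏ·w/pᵏ≡w = trans (solve 3 (λ P w r → P :* (w :* r) := w :* (P :* r)) refl (π^ k) w (recip (p ^ k)))
                      (trans (cong (w *_) (recip-inverse (p ^ k))) (*-identityʳ w))
    w/pᵏ·u≡z : w * recip (p ^ k) * u ≡ z
    w/pᵏ·u≡z = begin
      w * recip (p ^ k) * u          ≡⟨ solve 3 (λ w r u → w :* r :* u := r :* (w :* u)) refl w (recip (p ^ k)) u ⟩
      recip (p ^ k) * (w * u)        ≡⟨ cong (recip (p ^ k) *_) wu≡v ⟩
      recip (p ^ k) * (π^ k * z)     ≡⟨ solve 3 (λ r P z → r :* (P :* z) := (P :* r) :* z) refl (recip (p ^ k)) (π^ k) z ⟩
      (π^ k * recip (p ^ k)) * z     ≡⟨ cong (_* z) (recip-inverse (p ^ k)) ⟩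
      1ℚ * z                         ≡⟨ *-identityˡ z ⟩
      z ∎

  p∣pᵃ/i : ∀ a i → .{{ℕ.NonZero i}} → i ℕ.< p ^ a → Divisible 1 (ℕ→ℚ (p ^ a) * recip i)
  p∣pᵃ/i zero (suc i) (ℕ.s≤s ())
  p∣pᵃ/i (suc a) i i<pᵃ⁺¹ with p ∣? i
  ... | no p∤i = divisible (ℕ→ℚ (p ^ a) * recip i) (integral-* (integral-ℕ (p ^ a)) (integral-recip i p∤i)) (
    trans (cong (_* recip i) (ℕ→ℚ-* p (p ^ a)))
          (trans (solve 3 (λ P Q r → P :* Q :* r := P :* (Q :* r)) refl (ℕ→ℚ p) (ℕ→ℚ (p ^ a)) (recip i))
                 (cong (_* (ℕ→ℚ (p ^ a) * recip i)) (sym π^-1))))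
  ... | yes (divides i′ refl) = subst (Divisible 1) (sym cancel-p) (p∣pᵃ/i a i′ {{i′≢0}} i′<pᵃ)
    where
    i′≢0 : ℕ.NonZero i′
    i′≢0 = ℕP.m*n≢0⇒m≢0 i′
    i′<pᵃ : i′ ℕ.< p ^ a
    i′<pᵃ = ℕP.*-cancelʳ-< p i′ (p ^ a) (subst (i′ ℕ.* p ℕ.<_) (ℕP.*-comm p (p ^ a)) i<pᵃ⁺¹)
    cancel-p : ℕ→ℚ (p ^ suc a) * recip (i′ ℕ.* p) ≡ ℕ→ℚ (p ^ a) * recip i′
    cancel-p = begin
      ℕ→ℚ (p ℕ.* p ^ a) * recip (i′ ℕ.* p)             ≡⟨ cong₂ _*_ (ℕ→ℚ-* p (p ^ a)) (recip-* i′ p {{i′≢0}}) ⟩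
      ℕ→ℚ p * ℕ→ℚ (p ^ a) * (recip i′ * recip p)       ≡⟨ solve 4 (λ P Q r s → P :* Q :* (r :* s) := Q :* r :* (P :* s)) refl (ℕ→ℚ p) (ℕ→ℚ (p ^ a)) (recip i′) (recip p) ⟩
      ℕ→ℚ (p ^ a) * recip i′ * (ℕ→ℚ p * recip p)       ≡⟨ cong (ℕ→ℚ (p ^ a) * recip i′ *_) (recip-inverse p) ⟩
      ℕ→ℚ (p ^ a) * recip i′ * 1ℚ                      ≡⟨ *-identityʳ _ ⟩
      ℕ→ℚ (p ^ a) * recip i′ ∎
      where open ≡-Reasoning

module BinomialProducts (q : ℕ) (0<q : 0 < q) where
  open Embedding
  open FiniteSums
  open BinomialIdentities
  open import Defs
  open import Data.Rational using (ℚ; 1ℚ; _+_; _-_; _*_; -_)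
  open import Data.Rational.Properties using (*-identityʳ; *-assoc; *-comm)
  open import Data.Rational.Solver
  open +-*-Solver
  open import Data.Nat as ℕ using (suc; zero; _∸_)
  import Data.Nat.Properties as ℕP
  open import Data.Nat.Combinatorics using (_C_)
  open import Relation.Binary.PropositionalEquality

  Q : ℚ
  Q = ℕ→ℚ q

  x : ℕ → ℚ
  x i = Q * recip i

  Π⁺ Π⁻ : ℕ → ℚ
  Π⁺ n = prodℚ n (λ j → 1ℚ + x (suc j))
  Π⁻ n = prodℚ n (λ j → 1ℚ - x (suc j))

  1+[q-1]≡q : suc (q ∸ 1) ≡ q
  1+[q-1]≡q = ℕP.m+[n∸m]≡n 0<q

  divide-out : ∀ n X Y → X * ℕ→ℚ (suc n) ≡ Y → X ≡ Y * recip (suc n)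
  divide-out n X Y Xn≡Y = begin
    X                                   ≡⟨ sym (*-identityʳ X) ⟩
    X * 1ℚ                              ≡⟨ cong (X *_) (sym (recip-inverse (suc n))) ⟩
    X * (ℕ→ℚ (suc n) * recip (suc n))  ≡⟨ sym (*-assoc X _ _) ⟩
    X * ℕ→ℚ (suc n) * recip (suc n)    ≡⟨ cong (_* recip (suc n)) Xn≡Y ⟩
    Y * recip (suc n) ∎
    where open ≡-Reasoning

  divide-out-ℕ : ∀ N M k → N ℕ.* suc k ≡ M → ℕ→ℚ N ≡ ℕ→ℚ M * recip (suc k)
  divide-out-ℕ N M k Nk≡M = divide-out k (ℕ→ℚ N) (ℕ→ℚ M) (trans (sym (ℕ→ℚ-* N (suc k))) (cong ℕ→ℚ Nk≡M))

  C-upper : ∀ n → ℕ→ℚ ((q ℕ.+ n) C n) ≡ Π⁺ n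
  C-upper zero    = cong ℕ→ℚ (C-zero (q ℕ.+ 0))
  C-upper (suc n) = begin
    ℕ→ℚ ((q ℕ.+ suc n) C suc n)                        ≡⟨ cong (λ t → ℕ→ℚ (t C suc n)) (ℕP.+-suc q n) ⟩
    ℕ→ℚ (suc (q ℕ.+ n) C suc n)                        ≡⟨ divide-out-ℕ (suc (q ℕ.+ n) C suc n) (suc (q ℕ.+ n) ℕ.* ((q ℕ.+ n) C n)) n (absorption (q ℕ.+ n) n) ⟩
    ℕ→ℚ (suc (q ℕ.+ n) ℕ.* ((q ℕ.+ n) C n)) * r        ≡⟨ cong (_* r) (trans (ℕ→ℚ-* (suc (q ℕ.+ n)) ((q ℕ.+ n) C n)) (cong₂ _*_ q+n+1 (C-upper n))) ⟩
    (Q + N) * Π⁺ n * r                                 ≡⟨ solve 4 (λ Q N P r → (Q :+ N) :* P :* r := P :* (con 1ℚ :+ Q :* r) :+ P :* (N :* r :- con 1ℚ)) refl Q N (Π⁺ n) r ⟩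
    Π⁺ n * (1ℚ + x (suc n)) + Π⁺ n * (N * r - 1ℚ)     ≡⟨ cong (λ t → Π⁺ n * (1ℚ + x (suc n)) + Π⁺ n * (t - 1ℚ)) (recip-inverse (suc n)) ⟩
    Π⁺ n * (1ℚ + x (suc n)) + Π⁺ n * (1ℚ - 1ℚ)       ≡⟨ solve 2 (λ a b → a :+ b :* (con 1ℚ :- con 1ℚ) := a) refl (Π⁺ n * (1ℚ + x (suc n))) (Π⁺ n) ⟩
    Π⁺ (suc n) ∎
    where
    open ≡-Reasoning
    N r : ℚ
    N = ℕ→ℚ (suc n)
    r = recip (suc n)
    q+n+1 : ℕ→ℚ (suc (q ℕ.+ n)) ≡ Q + N
    q+n+1 = trans (cong ℕ→ℚ (sym (ℕP.+-suc q n))) (ℕ→ℚ-+ q (suc n))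

  C-lower : ∀ n → n ℕ.< q → ℕ→ℚ ((q ∸ 1) C n) ≡ neg1^ n * Π⁻ n
  C-lower zero    n<q = cong ℕ→ℚ (C-zero (q ∸ 1))
  C-lower (suc n) n<q = begin
    ℕ→ℚ ((q ∸ 1) C suc n)                              ≡⟨ divide-out-ℕ ((q ∸ 1) C suc n) (((q ∸ 1) C n) ℕ.* ((q ∸ 1) ∸ n)) n (C-consecutive (q ∸ 1) n) ⟩
    ℕ→ℚ (((q ∸ 1) C n) ℕ.* ((q ∸ 1) ∸ n)) * r          ≡⟨ cong (_* r) (trans (ℕ→ℚ-* ((q ∸ 1) C n) ((q ∸ 1) ∸ n)) (cong₂ _*_ (C-lower n (ℕP.<-trans (ℕP.n<1+n n) n<q)) q-1-n)) ⟩
    neg1^ n * Π⁻ n * (Q - N) * r                       ≡⟨ solve 5 (λ s P Q N r → s :* P :* (Q :- N) :* r := (:- s) :* (P :* (con 1ℚ :- Q :* r)) :+ s :* P :* (con 1ℚ :- N :* r)) refl (neg1^ n) (Π⁻ n) Q N r ⟩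
    (- neg1^ n) * (Π⁻ n * (1ℚ - x (suc n))) + neg1^ n * Π⁻ n * (1ℚ - N * r)
                                                       ≡⟨ cong (λ t → (- neg1^ n) * (Π⁻ n * (1ℚ - x (suc n))) + neg1^ n * Π⁻ n * (1ℚ - t)) (recip-inverse (suc n)) ⟩
    (- neg1^ n) * (Π⁻ n * (1ℚ - x (suc n))) + neg1^ n * Π⁻ n * (1ℚ - 1ℚ)
                                                       ≡⟨ solve 2 (λ a b → a :+ b :* (con 1ℚ :- con 1ℚ) := a) refl ((- neg1^ n) * (Π⁻ n * (1ℚ - x (suc n)))) (neg1^ n * Π⁻ n) ⟩
    neg1^ (suc n) * Π⁻ (suc n) ∎
    where
    open ≡-Reasoning
    N r : ℚ
    N = ℕ→ℚ (suc n)
    r = recip (suc n)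
    q-1-n : ℕ→ℚ ((q ∸ 1) ∸ n) ≡ Q - N
    q-1-n = trans (cong ℕ→ℚ (ℕP.∸-+-assoc q 1 n)) (ℕ→ℚ-∸ q (suc n) (ℕP.<⇒≤ n<q))

  C-top : ∀ d → ℕ→ℚ (q C suc d) ≡ x (suc d) * ℕ→ℚ ((q ∸ 1) C d)
  C-top d = begin
    ℕ→ℚ (q C suc d)                        ≡⟨ divide-out-ℕ (q C suc d) (q ℕ.* ((q ∸ 1) C d)) d (subst (λ t → (t C suc d) ℕ.* suc d ≡ t ℕ.* ((q ∸ 1) C d)) 1+[q-1]≡q (absorption (q ∸ 1) d)) ⟩
    ℕ→ℚ (q ℕ.* ((q ∸ 1) C d)) * recip (suc d) ≡⟨ cong (_* recip (suc d)) (ℕ→ℚ-* q ((q ∸ 1) C d)) ⟩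
    Q * ℕ→ℚ ((q ∸ 1) C d) * recip (suc d)  ≡⟨ solve 3 (λ a b c → a :* b :* c := a :* c :* b) refl Q (ℕ→ℚ ((q ∸ 1) C d)) (recip (suc d)) ⟩
    x (suc d) * ℕ→ℚ ((q ∸ 1) C d) ∎
    where open ≡-Reasoning

  C-central : ℕ→ℚ ((2 ℕ.* q) C q) ≡ ℕ→ℚ 2 * Π⁺ (q ∸ 1)
  C-central = begin
    ℕ→ℚ ((2 ℕ.* q) C q)                             ≡⟨ cong ℕ→ℚ (subst (λ t → (2 ℕ.* t) C t ≡ 2 ℕ.* ((t ℕ.+ (q ∸ 1)) C (q ∸ 1))) 1+[q-1]≡q (central-C (q ∸ 1))) ⟩
    ℕ→ℚ (2 ℕ.* ((q ℕ.+ (q ∸ 1)) C (q ∸ 1)))       ≡⟨ ℕ→ℚ-* 2 ((q ℕ.+ (q ∸ 1)) C (q ∸ 1)) ⟩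
    ℕ→ℚ 2 * ℕ→ℚ ((q ℕ.+ (q ∸ 1)) C (q ∸ 1))       ≡⟨ cong (ℕ→ℚ 2 *_) (C-upper (q ∸ 1)) ⟩
    ℕ→ℚ 2 * Π⁺ (q ∸ 1) ∎
    where open ≡-Reasoning

  C-split : ∀ d → d ℕ.≤ q → ℕ→ℚ ((2 ℕ.* q) C (q ℕ.+ d)) * Π⁺ d ≡ ℕ→ℚ (q C d) * (ℕ→ℚ 2 * Π⁺ (q ∸ 1))
  C-split d d≤q = begin
    ℕ→ℚ ((2 ℕ.* q) C (q ℕ.+ d)) * Π⁺ d                         ≡⟨ cong (ℕ→ℚ ((2 ℕ.* q) C (q ℕ.+ d)) *_) (sym (C-upper d)) ⟩
    ℕ→ℚ ((2 ℕ.* q) C (q ℕ.+ d)) * ℕ→ℚ ((q ℕ.+ d) C d)         ≡⟨ sym (ℕ→ℚ-* ((2 ℕ.* q) C (q ℕ.+ d)) ((q ℕ.+ d) C d)) ⟩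
    ℕ→ℚ (((2 ℕ.* q) C (q ℕ.+ d)) ℕ.* ((q ℕ.+ d) C d))         ≡⟨ cong ℕ→ℚ (central-split q d d≤q) ⟩
    ℕ→ℚ (((2 ℕ.* q) C q) ℕ.* (q C d))                         ≡⟨ ℕ→ℚ-* ((2 ℕ.* q) C q) (q C d) ⟩
    ℕ→ℚ ((2 ℕ.* q) C q) * ℕ→ℚ (q C d)                         ≡⟨ cong (_* ℕ→ℚ (q C d)) C-central ⟩
    ℕ→ℚ 2 * Π⁺ (q ∸ 1) * ℕ→ℚ (q C d)                         ≡⟨ *-comm (ℕ→ℚ 2 * Π⁺ (q ∸ 1)) (ℕ→ℚ (q C d)) ⟩
    ℕ→ℚ (q C d) * (ℕ→ℚ 2 * Π⁺ (q ∸ 1)) ∎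
    where open ≡-Reasoning

  x-pair : ∀ i j → suc i ℕ.+ suc j ≡ q → x (suc i) + x (suc j) ≡ x (suc i) * x (suc j)
  x-pair i j i+j≡q = begin
    Q * r + Q * s                     ≡⟨ solve 3 (λ Q a b → Q :* a :+ Q :* b := Q :* a :* con 1ℚ :+ Q :* b :* con 1ℚ) refl Q r s ⟩
    Q * r * 1ℚ + Q * s * 1ℚ           ≡⟨ cong₂ (λ u v → Q * r * u + Q * s * v) (sym (recip-inverse (suc j))) (sym (recip-inverse (suc i))) ⟩
    Q * r * (J′ * s) + Q * s * (I′ * r) ≡⟨ solve 5 (λ Q a b m n → Q :* a :* (n :* b) :+ Q :* b :* (m :* a) := Q :* a :* ((m :+ n) :* b)) refl Q r s I′ J′ ⟩
    Q * r * ((I′ + J′) * s)             ≡⟨ cong (λ t → Q * r * (t * s)) (trans (sym (ℕ→ℚ-+ (suc i) (suc j))) (cong ℕ→ℚ i+j≡q)) ⟩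
    Q * r * (Q * s) ∎
    where
    open ≡-Reasoning
    r s I′ J′ : ℚ
    r = recip (suc i)
    s = recip (suc j)
    I′ = ℕ→ℚ (suc i)
    J′ = ℕ→ℚ (suc j)

  x-complement : ∀ d → suc d ℕ.< q → x (q ∸ suc d) * (1ℚ - x (suc d)) ≡ - x (suc d)
  x-complement d d<q with ℕP.m<n⇒0<n∸m d<q
  ... | 0<q-d = begin
    Q * r′ * (1ℚ - Q * r)                 ≡⟨ cong (λ z → Q * r′ * (z - Q * r)) (sym (recip-inverse (suc d))) ⟩
    Q * r′ * (D * r - Q * r)              ≡⟨ solve 4 (λ Q r′ D r → Q :* r′ :* (D :* r :- Q :* r) := :- (Q :* r) :* ((Q :- D) :* r′)) refl Q r′ D r ⟩
    - (Q * r) * ((Q - D) * r′)            ≡⟨ cong (λ z → - (Q * r) * (z * r′)) (sym (ℕ→ℚ-∸ q (suc d) (ℕP.<⇒≤ d<q))) ⟩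
    - (Q * r) * (ℕ→ℚ (q ∸ suc d) * r′)   ≡⟨ cong (λ z → - (Q * r) * z) (recip-inverse (q ∸ suc d) {{ℕ.>-nonZero 0<q-d}}) ⟩
    - (Q * r) * 1ℚ                        ≡⟨ *-identityʳ _ ⟩
    - x (suc d) ∎
    where
    open ≡-Reasoning
    r r′ D : ℚ
    r = recip (suc d)
    r′ = recip (q ∸ suc d)
    D = ℕ→ℚ (suc d)

-- Every x_i = q/i (0 < i < q)
-- is divisible by p, so the products Π⁺, Π⁻ are ≡ 1 (mod p) and the central
-- product Y = Π⁺(q-1) = C(2q-1, q-1) is ≡ 2 + (-1)^p (mod p²).
module Congruences (p : ℕ) (pr : Prime p) (a′ : ℕ) where
  open Embedding
  open FiniteSums
  open Parity
  open PAdic p pr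
  open ThreeConsecutive using (F-three)
  open import Defs
  open import Data.Rational using (ℚ; 0ℚ; 1ℚ; ½; _+_; _-_; _*_; -_)
  open import Data.Rational.Properties using (*-identityʳ; *-assoc)
  open import Data.Rational.Solver
  open +-*-Solver
  open import Data.Nat as ℕ using (suc; _∸_; _^_)
  import Data.Nat.Properties as ℕP
  open import Data.Nat.Combinatorics using (_C_)
  open import Data.Product using (_,_)
  open import Data.Sum using (inj₁; inj₂)
  open import Relation.Binary.PropositionalEquality

  q : ℕ
  q = p ^ suc a′

  open BinomialProducts q (ℕP.m^n>0 p (suc a′))

  p∣x : ∀ i → suc i < q → Divisible 1 (x (suc i))
  p∣x i i<q = p∣pᵃ/i (suc a′) (suc i) i<q

  Π⁺≡1 : ∀ n → n < q → OneMod 1 (Π⁺ n)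
  Π⁺≡1 n n<q = prod-one-mod 1 n _ (λ j j<n →
    subst (Divisible 1) (solve 1 (λ t → t := (con 1ℚ :+ t) :- con 1ℚ) refl (x (suc j))) (p∣x j (ℕP.≤-<-trans j<n n<q)))

  Π⁻≡1 : ∀ n → n < q → OneMod 1 (Π⁻ n)
  Π⁻≡1 n n<q = prod-one-mod 1 n _ (λ j j<n →
    subst (Divisible 1) (solve 1 (λ t → :- t := (con 1ℚ :- t) :- con 1ℚ) refl (x (suc j))) (divisible-neg (p∣x j (ℕP.≤-<-trans j<n n<q))))

  -- (1 + x)(1 - x) = 1 - x², so the product of the two is ≡ 1 even modulo p²
  Π⁺Π⁻≡1 : ∀ n → n < q → OneMod 2 (Π⁺ n * Π⁻ n)
  Π⁺Π⁻≡1 n n<q = subst (OneMod 2) (prod-* n (λ j → 1ℚ + x (suc j)) (λ j → 1ℚ - x (suc j)))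
    (prod-one-mod 2 n _ (λ j j<n → let p∣xⱼ = p∣x j (ℕP.≤-<-trans j<n n<q) in
      subst (Divisible 2) (solve 1 (λ t → :- (t :* t) := (con 1ℚ :+ t) :* (con 1ℚ :- t) :- con 1ℚ) refl (x (suc j)))
        (divisible-neg (divisible-* p∣xⱼ p∣xⱼ))))

  Y : ℚ
  Y = Π⁺ (q ∸ 1)

  -- for i + j = q:  (1 + x_i)(1 + x_j) = 1 + 2 x_i x_j ≡ 1 (mod p²)
  pair≡1 : ∀ i j → suc i ℕ.+ suc j ≡ q → OneMod 2 ((1ℚ + x (suc i)) * (1ℚ + x (suc j)))
  pair≡1 i j i+j≡q = subst (Divisible 2) 2xᵢxⱼ≡ (divisible-*-integral (divisible-* (p∣x i i<q) (p∣x j j<q)) (integral-ℕ 2))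
    where
    open ≡-Reasoning
    i<q : suc i < q
    i<q = subst (suc i ℕ.<_) i+j≡q (ℕP.m<m+n (suc i) (ℕ.s≤s ℕ.z≤n))
    j<q : suc j < q
    j<q = subst (suc j ℕ.<_) i+j≡q (ℕP.m<n+m (suc j) (ℕ.s≤s ℕ.z≤n))
    2xᵢxⱼ≡ : x (suc i) * x (suc j) * ℕ→ℚ 2 ≡ (1ℚ + x (suc i)) * (1ℚ + x (suc j)) - 1ℚ
    2xᵢxⱼ≡ = begin
      x (suc i) * x (suc j) * ℕ→ℚ 2                   ≡⟨ solve 2 (λ a b → a :* b :* con (ℕ→ℚ 2) := a :* b :+ a :* b) refl (x (suc i)) (x (suc j)) ⟩
      x (suc i) * x (suc j) + x (suc i) * x (suc j)   ≡⟨ cong (_+ x (suc i) * x (suc j)) (sym (x-pair i j i+j≡q)) ⟩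
      (x (suc i) + x (suc j)) + x (suc i) * x (suc j) ≡⟨ solve 2 (λ a b → (a :+ b) :+ a :* b := (con 1ℚ :+ a) :* (con 1ℚ :+ b) :- con 1ℚ) refl (x (suc i)) (x (suc j)) ⟩
      (1ℚ + x (suc i)) * (1ℚ + x (suc j)) - 1ℚ ∎

  g : ℕ → ℚ
  g j = 1ℚ + x (suc j)

  -- q = 2m+1: the q-1 = 2m factors of Y pair up as {j, q-2-j}
  Y≡1 : ∀ m → q ≡ suc (m ℕ.+ m) → OneMod 2 Y
  Y≡1 m q≡2m+1 = subst (OneMod 2) (sym (trans (cong (λ t → Π⁺ (t ∸ 1)) q≡2m+1) (prod-pairs-even m g)))
    (prod-one-mod 2 m _ (λ j j<m → pair≡1 j (m ℕ.+ m ∸ suc j) (partners j j<m)))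
    where
    partners : ∀ j → j ℕ.< m → suc j ℕ.+ suc (m ℕ.+ m ∸ suc j) ≡ q
    partners j j<m = trans (cong suc (ℕP.+-suc j (m ℕ.+ m ∸ suc j)))
      (trans (cong suc (ℕP.m+[n∸m]≡n {suc j} {m ℕ.+ m} (ℕP.≤-trans j<m (ℕP.m≤m+n m m)))) (sym q≡2m+1))

  -- q = 2m+2: the 2m+1 factors pair up as {j, q-2-j}, leaving the middle one 1 + q/(m+1) = 3
  Y≡3 : ∀ m → q ≡ suc m ℕ.+ suc m → Divisible 2 (Y - ℕ→ℚ 3)
  Y≡3 m q≡2m+2 = subst (Divisible 2) Y-3≡ (divisible-*-integral (prod-one-mod 2 m _ (λ j j<m → pair≡1 j (m ℕ.+ m ∸ j) (partners j j<m))) (integral-ℕ 3))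
    where
    open ≡-Reasoning
    q≡ : q ≡ suc (suc (m ℕ.+ m))
    q≡ = trans q≡2m+2 (cong suc (ℕP.+-suc m m))
    partners : ∀ j → j ℕ.< m → suc j ℕ.+ suc (m ℕ.+ m ∸ j) ≡ q
    partners j j<m = trans (cong suc (ℕP.+-suc j (m ℕ.+ m ∸ j)))
      (trans (cong (suc ∘′ suc) (ℕP.m+[n∸m]≡n {j} {m ℕ.+ m} (ℕP.≤-trans (ℕP.<⇒≤ j<m) (ℕP.m≤m+n m m)))) (sym q≡))
      where open import Function using (_∘′_)
    pairs : ℚ
    pairs = prodℚ m (λ j → g j * g (m ℕ.+ m ∸ j))
    middle : g m ≡ ℕ→ℚ 3
    middle = begin
      1ℚ + Q * recip (suc m)                                      ≡⟨ cong (λ t → 1ℚ + ℕ→ℚ t * recip (suc m)) q≡2m+2 ⟩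
      1ℚ + ℕ→ℚ (suc m ℕ.+ suc m) * recip (suc m)                  ≡⟨ cong (λ t → 1ℚ + t * recip (suc m)) (ℕ→ℚ-+ (suc m) (suc m)) ⟩
      1ℚ + (ℕ→ℚ (suc m) + ℕ→ℚ (suc m)) * recip (suc m)            ≡⟨ solve 2 (λ a r → con 1ℚ :+ (a :+ a) :* r := con 1ℚ :+ a :* r :+ a :* r) refl (ℕ→ℚ (suc m)) (recip (suc m)) ⟩
      1ℚ + ℕ→ℚ (suc m) * recip (suc m) + ℕ→ℚ (suc m) * recip (suc m) ≡⟨ cong (λ t → 1ℚ + t + t) (recip-inverse (suc m)) ⟩
      ℕ→ℚ 3 ∎
    Y-3≡ : (pairs - 1ℚ) * ℕ→ℚ 3 ≡ Y - ℕ→ℚ 3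
    Y-3≡ = begin
      (pairs - 1ℚ) * ℕ→ℚ 3                 ≡⟨ solve 1 (λ P → (P :- con 1ℚ) :* con (ℕ→ℚ 3) := P :* con (ℕ→ℚ 3) :- con (ℕ→ℚ 3)) refl pairs ⟩
      pairs * ℕ→ℚ 3 - ℕ→ℚ 3                ≡⟨ cong (λ t → pairs * t - ℕ→ℚ 3) (sym middle) ⟩
      pairs * g m - ℕ→ℚ 3                  ≡⟨ cong (_- ℕ→ℚ 3) (sym (prod-pairs-odd m g)) ⟩
      prodℚ (suc (m ℕ.+ m)) g - ℕ→ℚ 3      ≡⟨ cong (λ t → Π⁺ (t ∸ 1) - ℕ→ℚ 3) (sym q≡) ⟩
      Y - ℕ→ℚ 3 ∎

  -- Y ≡ 2 + (-1)^p (mod p²):  Y ≡ 1 for odd p, Y ≡ 3 for p = 2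
  Y≡2+ε : Divisible 2 (Y - (ℕ→ℚ 2 + neg1^ p))
  Y≡2+ε with prime-parity pr
  ... | inj₂ odd@(m , refl) = let (h , q≡2h+1) = odd-^ odd (suc a′) in
    subst (λ ε → Divisible 2 (Y - (ℕ→ℚ 2 + ε))) (sym (neg1^-odd m)) (Y≡1 h q≡2h+1)
  ... | inj₁ refl = Y≡3 (2 ^ a′ ∸ 1) q≡2m+2
    where
    1+m≡2ᵃ′ : suc (2 ^ a′ ∸ 1) ≡ 2 ^ a′
    1+m≡2ᵃ′ = ℕP.m+[n∸m]≡n (ℕP.m^n>0 2 a′)
    q≡2m+2 : q ≡ suc (2 ^ a′ ∸ 1) ℕ.+ suc (2 ^ a′ ∸ 1)
    q≡2m+2 = trans (cong (2 ^ a′ ℕ.+_) (ℕP.+-identityʳ (2 ^ a′))) (sym (cong₂ ℕ._+_ 1+m≡2ᵃ′ 1+m≡2ᵃ′))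

  -- p ∣ 2(1 + (-1)^p): the factor 1 + (-1)^p vanishes for odd p, and 2(1 + 1) = 2·2 for p = 2
  p∣2[1+ε] : Divisible 1 (ℕ→ℚ 2 * (1ℚ + neg1^ p))
  p∣2[1+ε] with prime-parity pr
  ... | inj₂ (m , refl) = subst (λ ε → Divisible 1 (ℕ→ℚ 2 * (1ℚ + ε))) (sym (neg1^-odd m)) (divisible-zero 1)
  ... | inj₁ refl      = divisible (ℕ→ℚ 2) (integral-ℕ 2) refl

  module _ (d′ : ℕ) (d<q : suc d′ < q) where
    private
      d : ℕ
      d = suc d′
      ε σ G c B M M′ : ℚ
      ε = neg1^ p
      σ = neg1^ d
      G = ℕ→ℚ ((2 ℕ.* q) C (q ℕ.+ d))
      c = ℕ→ℚ (q C d)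
      B = Π⁺ d
      M = Π⁻ d
      M′ = Π⁻ d′
      d′<q : d′ < q
      d′<q = ℕP.<-trans (ℕP.n<1+n d′) d<q

    F-sum₃ target : ℚ
    F-sum₃ = F p (suc a′) (d ∸ 1) + F p (suc a′) d + F p (suc a′) (suc d)
    target = ℕ→ℚ 2 * c - Q * (neg1^ (q ∸ d) * recip d + neg1^ (q ∸ 1) * σ * recip (q ∸ d))

    T₁ T₂ : ℚ
    T₁ = ½ * G - ℕ→ℚ 2 * c - ε * σ * x (q ∸ d)
    T₂ = ½ * G - ε * σ * x d

    private
      GB≡2Yc : G * B ≡ c * (ℕ→ℚ 2 * Y)
      GB≡2Yc = C-split d (ℕP.<⇒≤ d<q)

      c≡-σxM′ : c ≡ - σ * (x d * M′)
      c≡-σxM′ = trans (C-top d′) (trans (cong (x d *_) (C-lower d′ d′<q))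
                  (solve 3 (λ x s M → x :* (s :* M) := :- (:- s) :* (x :* M)) refl (x d) (neg1^ d′) M′))

      T₁-scaled : T₁ * (B * (1ℚ - x d)) ≡ - σ * x d * (M * Y - ℕ→ℚ 2 * B * M - ε * B)
      T₁-scaled = begin
        T₁ * (B * (1ℚ - x d))
          ≡⟨ solve 9 (λ h G c e s w B x two → (h :* G :- two :* c :- e :* s :* w) :* (B :* (con 1ℚ :- x))
                := h :* (G :* B) :* (con 1ℚ :- x) :- two :* c :* B :* (con 1ℚ :- x) :- e :* s :* (w :* (con 1ℚ :- x)) :* B)
                refl ½ G c ε σ (x (q ∸ d)) B (x d) (ℕ→ℚ 2) ⟩
        ½ * (G * B) * (1ℚ - x d) - ℕ→ℚ 2 * c * B * (1ℚ - x d) - ε * σ * (x (q ∸ d) * (1ℚ - x d)) * B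
          ≡⟨ cong₂ (λ u v → ½ * u * (1ℚ - x d) - ℕ→ℚ 2 * c * B * (1ℚ - x d) - ε * σ * v * B) GB≡2Yc (x-complement d′ d<q) ⟩
        ½ * (c * (ℕ→ℚ 2 * Y)) * (1ℚ - x d) - ℕ→ℚ 2 * c * B * (1ℚ - x d) - ε * σ * (- x d) * B
          ≡⟨ cong (λ u → ½ * (u * (ℕ→ℚ 2 * Y)) * (1ℚ - x d) - ℕ→ℚ 2 * u * B * (1ℚ - x d) - ε * σ * (- x d) * B) c≡-σxM′ ⟩
        ½ * (- σ * (x d * M′) * (ℕ→ℚ 2 * Y)) * (1ℚ - x d) - ℕ→ℚ 2 * (- σ * (x d * M′)) * B * (1ℚ - x d) - ε * σ * (- x d) * B
          ≡⟨ solve 6 (λ x s M Y B e →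
                con ½ :* (:- s :* (x :* M) :* (con (ℕ→ℚ 2) :* Y)) :* (con 1ℚ :- x) :- con (ℕ→ℚ 2) :* (:- s :* (x :* M)) :* B :* (con 1ℚ :- x) :- e :* s :* (:- x) :* B
                := :- s :* x :* ((M :* (con 1ℚ :- x)) :* Y :- con (ℕ→ℚ 2) :* B :* (M :* (con 1ℚ :- x)) :- e :* B)) refl (x d) σ M′ Y B ε ⟩
        - σ * x d * (M * Y - ℕ→ℚ 2 * B * M - ε * B) ∎
        where open ≡-Reasoning

      T₂-scaled : T₂ * B ≡ - σ * x d * (M′ * Y + ε * B)
      T₂-scaled = begin
        T₂ * B
          ≡⟨ solve 6 (λ h G e s x B → (h :* G :- e :* s :* x) :* B := h :* (G :* B) :- e :* s :* x :* B) refl ½ G ε σ (x d) B ⟩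
        ½ * (G * B) - ε * σ * x d * B
          ≡⟨ cong (λ u → ½ * u - ε * σ * x d * B) GB≡2Yc ⟩
        ½ * (c * (ℕ→ℚ 2 * Y)) - ε * σ * x d * B
          ≡⟨ cong (λ u → ½ * (u * (ℕ→ℚ 2 * Y)) - ε * σ * x d * B) c≡-σxM′ ⟩
        ½ * (- σ * (x d * M′) * (ℕ→ℚ 2 * Y)) - ε * σ * x d * B
          ≡⟨ solve 6 (λ x s M Y B e → con ½ :* (:- s :* (x :* M) :* (con (ℕ→ℚ 2) :* Y)) :- e :* s :* x :* B
                                      := :- s :* x :* (M :* Y :+ e :* B)) refl (x d) σ M′ Y B ε ⟩
        - σ * x d * (M′ * Y + ε * B) ∎
        where open ≡-Reasoning

      -σx-divisible : ∀ {k z} → Divisible k z → Divisible (suc k) (- σ * x d * z)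
      -σx-divisible {k} {z} p^k∣z = subst (Divisible (suc k)) (solve 3 (λ x z s → x :* z :* (:- s) := :- s :* x :* z) refl (x d) z σ)
        (divisible-*-integral (divisible-* (p∣x d′ d<q) p^k∣z) (integral-neg (integral-neg1^ d)))

    T₁-divisible : Divisible 3 T₁
    T₁-divisible = divisible-÷-unit (one-mod-* {1} {B} {1ℚ - x d} (Π⁺≡1 d d<q) 1-x≡1) T₁-scaled
      (-σx-divisible (combination-mod-p² {B} {M} {Y} {ε} (integral-neg1^ p) (Π⁺≡1 d d<q) (Π⁻≡1 d d<q) (Π⁺Π⁻≡1 d d<q) Y≡2+ε p∣2[1+ε]))
      where
      1-x≡1 : OneMod 1 (1ℚ - x d)
      1-x≡1 = subst (Divisible 1) (solve 1 (λ t → :- t := (con 1ℚ :- t) :- con 1ℚ) refl (x d)) (divisible-neg (p∣x d′ d<q))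

    T₂-divisible : Divisible 2 T₂
    T₂-divisible = divisible-÷-unit (Π⁺≡1 d d<q) T₂-scaled
      (-σx-divisible (combination-mod-p {B} {M′} {Y} {ε} (integral-neg1^ p) (Π⁺≡1 d d<q) (Π⁻≡1 d′ d′<q) Y≡2+ε p∣2[1+ε]))

    private
      sign-q : neg1^ q ≡ ε
      sign-q = neg1^-power p a′

      sign[q-d] : neg1^ (q ∸ d) ≡ ε * σ
      sign[q-d] = begin
        neg1^ (q ∸ d)                 ≡⟨ sym (*-identityʳ (neg1^ (q ∸ d))) ⟩
        neg1^ (q ∸ d) * 1ℚ            ≡⟨ cong (_*_ (neg1^ (q ∸ d))) (sym (neg1^-square d)) ⟩
        neg1^ (q ∸ d) * (σ * σ)       ≡⟨ sym (*-assoc (neg1^ (q ∸ d)) σ σ) ⟩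
        neg1^ (q ∸ d) * σ * σ         ≡⟨ cong (_* σ) (sym (neg1^-+ (q ∸ d) d)) ⟩
        neg1^ (q ∸ d ℕ.+ d) * σ       ≡⟨ cong (λ t → neg1^ t * σ) (ℕP.m∸n+n≡m (ℕP.<⇒≤ d<q)) ⟩
        neg1^ q * σ                   ≡⟨ cong (_* σ) sign-q ⟩
        ε * σ ∎
        where open ≡-Reasoning

      sign[q-1] : neg1^ (q ∸ 1) ≡ - ε
      sign[q-1] = begin
        neg1^ (q ∸ 1)                 ≡⟨ solve 1 (λ s → s := :- (:- s)) refl (neg1^ (q ∸ 1)) ⟩
        - neg1^ (suc (q ∸ 1))         ≡⟨ cong (λ t → - neg1^ t) 1+[q-1]≡q ⟩
        - neg1^ q                     ≡⟨ cong -_ sign-q ⟩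
        - ε ∎
        where open ≡-Reasoning

      F-sum : F-sum₃ ≡ ½ * G + ε * Q * ((- σ) * recip d)
      F-sum = trans (F-three p (suc a′) d′ d<q)
                    (cong (λ s → ½ * G + ε * Q * (s * recip d)) (solve 1 (λ s → s := :- (:- s)) refl (neg1^ d′)))

      first-difference : F-sum₃ - target ≡ T₁
      first-difference = begin
        F-sum₃ - (ℕ→ℚ 2 * c - Q * (neg1^ (q ∸ d) * recip d + neg1^ (q ∸ 1) * σ * recip (q ∸ d)))
          ≡⟨ cong₂ (λ u v → u - (ℕ→ℚ 2 * c - Q * v)) F-sum (cong₂ (λ s t → s * recip d + t * σ * recip (q ∸ d)) sign[q-d] sign[q-1]) ⟩
        ½ * G + ε * Q * ((- σ) * recip d) - (ℕ→ℚ 2 * c - Q * (ε * σ * recip d + (- ε) * σ * recip (q ∸ d)))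
          ≡⟨ solve 9 (λ h G e Q s r two c′ r′ → h :* G :+ e :* Q :* ((:- s) :* r) :- (two :* c′ :- Q :* (e :* s :* r :+ (:- e) :* s :* r′))
                                          := h :* G :- two :* c′ :- e :* s :* (Q :* r′)) refl ½ G ε Q σ (recip d) (ℕ→ℚ 2) c (recip (q ∸ d)) ⟩
        T₁ ∎
        where open ≡-Reasoning

      second-difference : F-sum₃ - 0ℚ ≡ T₂
      second-difference = begin
        F-sum₃ - 0ℚ                              ≡⟨ cong (_- 0ℚ) F-sum ⟩
        ½ * G + ε * Q * ((- σ) * recip d) - 0ℚ
          ≡⟨ solve 6 (λ h G e Q s r → h :* G :+ e :* Q :* ((:- s) :* r) :- con 0ℚ := h :* G :- e :* s :* (Q :* r)) refl ½ G ε Q σ (recip d) ⟩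
        T₂ ∎
        where open ≡-Reasoning

    first-congruence : F-sum₃ ≡ target [mod p ^ 3 ]
    first-congruence = divisible⇒congruent {x = F-sum₃} {y = target} first-difference T₁-divisible

    second-congruence : F-sum₃ ≡ 0ℚ [mod p ^ 2 ]
    second-congruence = divisible⇒congruent {x = F-sum₃} {y = 0ℚ} second-difference T₂-divisible

open import Defs
open import Data.Nat using (ℕ; suc; _∸_; _^_; _≤_; _<_; s≤s; z≤n)
open import Data.Nat.Primality using (Prime)
open import Data.Nat.Combinatorics using (_C_)
open import Data.Rational using (ℚ; 0ℚ; _+_; _-_; _*_)
open import Data.Product using (_×_; _,_)
lemma3p1 : (p a d : ℕ) → Prime p → 1 ≤ a → 1 ≤ d → d < p ^ a →
  ((F p a (d ∸ 1) + F p a d + F p a (suc d))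
    ≡ (ℕ→ℚ 2 * ℕ→ℚ ((p ^ a) C d)
       - ℕ→ℚ (p ^ a) * (neg1^ (p ^ a ∸ d) * recip d
                         + neg1^ (p ^ a ∸ 1) * neg1^ d * recip (p ^ a ∸ d)))
    [mod p ^ 3 ])
  × ((F p a (d ∸ 1) + F p a d + F p a (suc d)) ≡ 0ℚ [mod p ^ 2 ])
lemma3p1 p (suc a′) (suc d′) pr (s≤s z≤n) (s≤s z≤n) d<pᵃ =
  first-congruence d′ d<pᵃ , second-congruence d′ d<pᵃ
  where open Congruences p pr a′ using (first-congruence; second-congruence)
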